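{- The one-way randomized communication complexity of the $(m,2^m)$-Sparse INDEX problem is $O(m\log m)$, while its online Merlin–Arthur communication complexity is $\Omega(m)$.
   Context: $(m,n)$-Sparse INDEX: Alice holds $x\in\{0,1\}^n$ of Hamming weight at most $m$, Bob holds an index $\iota\in[n]$; the output is $x_\iota$. Here $n=2^m$. One-way randomized communication complexity: minimum cost of a protocol in which Alice sends a single randomized message to Bob, who outputs the answer correctly with probability at least $2/3$. Online MA communication for $F:X\times Y\to\{0,1\}$: (1) Alice and Merlin see $x$; (2) Merlin, using private randomness $r_M$, sends Alice $\mathfrak h_1(x,r_M)$; (3) Bob receives $y$; (4) Merlin sends Bob $\mathfrak h_2(x,y,r_M)$; (5) Alice sends Bob a message that may use a public random string $r_A$ unknown to Merlin, and Bob outputs a bit. It is $\delta_c$-complete and $\delta_s$-sound if there are help functions such that: if $F(x,y)=1$ then $\Pr_{r_M,r_A}[\text{output}=0]\le\delta_c$; if $F(x,y)=0$ then for all help messages $\Pr_{r_A}[\text{output}=1]\le\delta_s$. The error is the least $\max\{\delta_s,\delta_c\}$; hcost $=1+\max(|\mathfrak h_1|+|\mathfrak h_2|)$; vcost is the maximum number of bits exchanged by Alice and Bob. The online MA communication complexity of $F$ is the minimum of hcost $+$ vcost over online MA protocols with error at most $1/3$. -}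

module Defs where

open import Data.Nat using (ℕ; zero; suc; _+_; _*_; _^_; _≤_)
open import Data.Bool using (Bool; true; false; if_then_else_; not; _xor_)
open import Data.Vec using (Vec; []; _∷_; lookup)
open import Data.Fin using (Fin)
open import Data.Product using (Σ; proj₁)
open import Relation.Binary.PropositionalEquality using (_≡_)

-- A probability Pr_r[p r] is countBits ℓ p / 2^ℓ.

sumBits : (ℓ : ℕ) → (Vec Bool ℓ → ℕ) → ℕ
sumBits zero    f = f []
sumBits (suc ℓ) f = sumBits ℓ (λ v → f (false ∷ v)) + sumBits ℓ (λ v → f (true ∷ v))

countBits : (ℓ : ℕ) → (Vec Bool ℓ → Bool) → ℕ
countBits ℓ p = sumBits ℓ (λ v → if p v then 1 else 0)

_==_ : Bool → Bool → Bool
a == b = not (a xor b)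

record OneWayProtocol (X Y : Set) : Set where
  field
    alen  : ℕ
    blen  : ℕ
    cost  : ℕ
    alice : X → Vec Bool alen → Vec Bool cost
    bob   : Y → Vec Bool blen → Vec Bool cost → Bool

-- correct with probability at least 2/3 on every input
OneWayCorrect : {X Y : Set} → (X → Y → Bool) → OneWayProtocol X Y → Set
OneWayCorrect {X} {Y} F P =
  (x : X) (y : Y) →
  2 * (2 ^ alen * 2 ^ blen)
    ≤ 3 * sumBits alen (λ ra → countBits blen (λ rb → bob y rb (alice x ra) == F x y))
  where open OneWayProtocol P

-- Merlin's private random string r_M has length mlen; the public random
-- string r_A of Alice/Bob has length rlen (unknown to Merlin).

record OnlineMAProtocol (X Y : Set) : Set where
  field
    mlen rlen k₁ k₂ v : ℕ
    h₁    : X → Vec Bool mlen → Vec Bool k₁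
    h₂    : X → Y → Vec Bool mlen → Vec Bool k₂
    alice : X → Vec Bool k₁ → Vec Bool rlen → Vec Bool v
    bob   : Y → Vec Bool k₂ → Vec Bool rlen → Vec Bool v → Bool

  hcost : ℕ
  hcost = 1 + (k₁ + k₂)

  vcost : ℕ
  vcost = v

  cost : ℕ
  cost = hcost + vcost

-- δ_c ≤ 1/3 and δ_s ≤ 1/3, i.e. error at most 1/3
OnlineMACorrect : {X Y : Set} → (X → Y → Bool) → OnlineMAProtocol X Y → Set
OnlineMACorrect {X} {Y} F P =
  ((x : X) (y : Y) → F x y ≡ true →
     3 * sumBits mlen (λ rM → countBits rlen (λ rA →
            not (bob y (h₂ x y rM) rA (alice x (h₁ x rM) rA))))
       ≤ 2 ^ mlen * 2 ^ rlen)
  Data.Product.× 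
  ((x : X) (y : Y) → F x y ≡ false →
     (w₁ : Vec Bool k₁) (w₂ : Vec Bool k₂) →
     3 * countBits rlen (λ rA → bob y w₂ rA (alice x w₁ rA)) ≤ 2 ^ rlen)
  where open OnlineMAProtocol P

weight : {n : ℕ} → Vec Bool n → ℕ
weight []          = 0
weight (b ∷ bs) = (if b then 1 else 0) + weight bs

SparseX : ℕ → Set
SparseX m = Σ (Vec Bool (2 ^ m)) (λ x → weight x ≤ m)

SparseY : ℕ → Set
SparseY m = Fin (2 ^ m)

SparseINDEX : (m : ℕ) → SparseX m → SparseY m → Bool
SparseINDEX m x ι = lookup (proj₁ x) ι

-- Alice sends a uniformly random k × m matrix M over GF(2), k = ⌈log₂ m⌉ + 2,
-- together with the hashes M·i of the at most m indices i in the support of x; Bob accepts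
-- iff M·ι is one of them. Two distinct indices collide with probability 2^-k ≤ 1/(4m), so
-- by a union bound over the support Bob errs with probability at most 1/4.
--
-- Write m = L + n with 2^L ≤ m < 2^(L+1). A function g : {0,1}^L → {0,1}^n
-- yields an input of weight 2^L, the indicator of its graph, on which the query (j, u)
-- asks whether g j = u. Fix Merlin's coins so that the protocol is complete on average
-- over j; then it is complete with probability ≥ 13/20 on at least 2^L/21 points j.
-- Repeat the Alice–Bob phase 2s times with shared coins rs, s = 8(m + |h₂| + 2), and let
-- Bob accept (j, u) when some help message makes him accept in more than s runs. By
-- Chernoff bounds and a union bound over all (j, u) and help messages, for a suitable
-- fixed rs Alice's 2s messages determine g on at least 2^L/21 points for at least half of
-- all g. Counting functions gives n·2^L/21 ≤ 1 + 2s·vcost, and since n ≥ m/2 and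
-- 2^L/21 ≥ m/42 - 1 this forces m = O(hcost + vcost).

module Submission where

open import Defs
open import Data.Nat
open import Data.Nat.Properties
open import Data.Nat.DivMod using (_/_; _%_; /-monoˡ-≤; m*n/n≡m; m≡m%n+[m/n]*n; m%n<n)
open import Data.Nat.Induction using (<-rec)
open import Data.Nat.ListAction using (sum)
open import Data.Nat.Logarithm using (⌈log₂_⌉; ⌈log₂⌉-mono-≤; ⌈log₂⌈n/2⌉⌉≡⌈log₂n⌉∸1)
open import Data.Nat.Tactic.RingSolver using (solve-∀)
open import Data.Bool using (Bool; true; false; if_then_else_; not; _∧_; _∨_; _xor_)
open import Data.Bool.ListAction using (any; or)
open import Data.Bool.Properties using (xor-same; xor-identityʳ; ∧-distribˡ-xor; not-distribˡ-xor;
  not-distribʳ-xor; xor-∧-commutativeRing; ∨-zeroʳ; ∧-zeroʳ; ∧-identityʳ; ∧-conicalˡ; ∧-conicalʳ;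
  not-involutive)
import Data.Bool.Properties as Bool
open import Data.Vec using (Vec; []; _∷_; _++_; take; drop; lookup; replicate)
open import Data.Vec.Properties using (≡-dec; ∷-injectiveˡ; ∷-injectiveʳ; lookup-++ˡ; lookup-++ʳ)
open import Data.List using (List; []; _∷_; length)
import Data.List as List
open import Data.List.Properties using (length-map; map-∘)
open import Data.Fin using (Fin; zero; suc; remQuot; combine; _↑ˡ_; _↑ʳ_)
open import Data.Fin.Properties using (combine-remQuot)
open import Data.Product using (Σ; _,_; proj₁; proj₂; _×_; ∃-syntax)
open import Data.Empty using (⊥-elim)
open import Data.Unit using (tt)
open import Relation.Binary.PropositionalEquality
open import Relation.Nullary using (Dec; yes; no)
open import Relation.Nullary.Decidable using (⌊_⌋; isYes≗does; dec-true)
open import Algebra.Bundles using (CommutativeRing)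
open import Algebra.Properties.CommutativeSemigroup +-commutativeSemigroup
  using () renaming (interchange to +-interchange)
open import Algebra.Properties.CommutativeSemigroup *-commutativeSemigroup
  using (x∙yz≈y∙xz; x∙yz≈z∙xy) renaming (interchange to *-interchange)
open import Algebra.Properties.CommutativeSemigroup
  (CommutativeRing.+-commutativeSemigroup xor-∧-commutativeRing)
  using () renaming (interchange to xor-interchange)

-- Indicators and sums over bit strings

𝟙 : Bool → ℕ
𝟙 b = if b then 1 else 0

𝟙≤1 : ∀ b → 𝟙 b ≤ 1
𝟙≤1 true  = ≤-refl
𝟙≤1 false = z≤n

𝟙-mono : ∀ {a b} → (a ≡ true → b ≡ true) → 𝟙 a ≤ 𝟙 b
𝟙-mono {false}        _   = z≤n
𝟙-mono {true} {true}  _   = ≤-refl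
𝟙-mono {true} {false} a⇒b with a⇒b refl
... | ()

not-∨-intro : ∀ {a b} → (a ≡ true → b ≡ true) → (not a ∨ b) ≡ true
not-∨-intro {false} _   = refl
not-∨-intro {true}  a⇒b = a⇒b refl

𝟙-∧ : ∀ a b → 𝟙 (a ∧ b) ≡ 𝟙 a * 𝟙 b
𝟙-∧ true  b = sym (+-identityʳ (𝟙 b))
𝟙-∧ false b = refl

𝟙-∨ : ∀ a b → 𝟙 (a ∨ b) ≤ 𝟙 a + 𝟙 b
𝟙-∨ true  b = s≤s z≤n
𝟙-∨ false b = ≤-refl

𝟙-not-∧ : ∀ a b → 𝟙 (not (a ∧ b)) ≤ 𝟙 (not a) + 𝟙 (not b)
𝟙-not-∧ true  b = ≤-refl
𝟙-not-∧ false b = s≤s z≤n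

𝟙+𝟙-not : ∀ b → 𝟙 b + 𝟙 (not b) ≡ 1
𝟙+𝟙-not true  = refl
𝟙+𝟙-not false = refl

take-++ : ∀ {A : Set} {m n} (u : Vec A m) (w : Vec A n) → take m (u ++ w) ≡ u
take-++ []      w = refl
take-++ (a ∷ u) w = cong (a ∷_) (take-++ u w)

drop-++ : ∀ {A : Set} {m n} (u : Vec A m) (w : Vec A n) → drop m (u ++ w) ≡ w
drop-++ []      w = refl
drop-++ (a ∷ u) w = drop-++ u w

sumBits-cong : ∀ ℓ {f g : Vec Bool ℓ → ℕ} → (∀ v → f v ≡ g v) → sumBits ℓ f ≡ sumBits ℓ g
sumBits-cong zero    f≡g = f≡g []
sumBits-cong (suc ℓ) f≡g =
  cong₂ _+_ (sumBits-cong ℓ (λ v → f≡g (false ∷ v))) (sumBits-cong ℓ (λ v → f≡g (true ∷ v)))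

sumBits-mono : ∀ ℓ {f g : Vec Bool ℓ → ℕ} → (∀ v → f v ≤ g v) → sumBits ℓ f ≤ sumBits ℓ g
sumBits-mono zero    f≤g = f≤g []
sumBits-mono (suc ℓ) f≤g =
  +-mono-≤ (sumBits-mono ℓ (λ v → f≤g (false ∷ v))) (sumBits-mono ℓ (λ v → f≤g (true ∷ v)))

sumBits-const : ∀ ℓ c → sumBits ℓ (λ _ → c) ≡ 2 ^ ℓ * c
sumBits-const zero    c = sym (+-identityʳ c)
sumBits-const (suc ℓ) c = begin
  sumBits ℓ (λ _ → c) + sumBits ℓ (λ _ → c) ≡⟨ cong₂ _+_ (sumBits-const ℓ c) (sumBits-const ℓ c) ⟩
  2 ^ ℓ * c + 2 ^ ℓ * c                     ≡⟨ *-distribʳ-+ c (2 ^ ℓ) (2 ^ ℓ) ⟨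
  (2 ^ ℓ + 2 ^ ℓ) * c                       ≡⟨ cong (λ z → (2 ^ ℓ + z) * c) (+-identityʳ (2 ^ ℓ)) ⟨
  2 ^ suc ℓ * c                             ∎
  where open ≡-Reasoning

countBits-true : ∀ ℓ → countBits ℓ (λ _ → true) ≡ 2 ^ ℓ
countBits-true ℓ = trans (sumBits-const ℓ 1) (*-identityʳ (2 ^ ℓ))

countBits-false : ∀ ℓ → countBits ℓ (λ _ → false) ≡ 0
countBits-false ℓ = trans (sumBits-const ℓ 0) (*-zeroʳ (2 ^ ℓ))

sumBits-+ : ∀ ℓ (f g : Vec Bool ℓ → ℕ) → sumBits ℓ (λ v → f v + g v) ≡ sumBits ℓ f + sumBits ℓ g
sumBits-+ zero    f g = refl
sumBits-+ (suc ℓ) f g = begin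
  sumBits ℓ (λ v → f (false ∷ v) + g (false ∷ v)) + sumBits ℓ (λ v → f (true ∷ v) + g (true ∷ v))
    ≡⟨ cong₂ _+_ (sumBits-+ ℓ _ _) (sumBits-+ ℓ _ _) ⟩
  (sumBits ℓ (λ v → f (false ∷ v)) + sumBits ℓ (λ v → g (false ∷ v)))
    + (sumBits ℓ (λ v → f (true ∷ v)) + sumBits ℓ (λ v → g (true ∷ v)))
    ≡⟨ +-interchange (sumBits ℓ (λ v → f (false ∷ v))) _ _ _ ⟩
  sumBits (suc ℓ) f + sumBits (suc ℓ) g ∎
  where open ≡-Reasoning

countBits+countBits-not : ∀ ℓ (p : Vec Bool ℓ → Bool) → countBits ℓ p + countBits ℓ (λ v → not (p v)) ≡ 2 ^ ℓ
countBits+countBits-not ℓ p = begin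
  countBits ℓ p + countBits ℓ (λ v → not (p v)) ≡⟨ sumBits-+ ℓ _ _ ⟨
  sumBits ℓ (λ v → 𝟙 (p v) + 𝟙 (not (p v)))     ≡⟨ sumBits-cong ℓ (λ v → 𝟙+𝟙-not (p v)) ⟩
  countBits ℓ (λ _ → true)                      ≡⟨ countBits-true ℓ ⟩
  2 ^ ℓ                                         ∎
  where open ≡-Reasoning

sumBits-*ˡ : ∀ ℓ c (f : Vec Bool ℓ → ℕ) → sumBits ℓ (λ v → c * f v) ≡ c * sumBits ℓ f
sumBits-*ˡ zero    c f = refl
sumBits-*ˡ (suc ℓ) c f = trans (cong₂ _+_ (sumBits-*ˡ ℓ c _) (sumBits-*ˡ ℓ c _)) (sym (*-distribˡ-+ c _ _))

sumBits-++ : ∀ a b (f : Vec Bool (a + b) → ℕ) →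
             sumBits (a + b) f ≡ sumBits a (λ u → sumBits b (λ w → f (u ++ w)))
sumBits-++ zero    b f = refl
sumBits-++ (suc a) b f = cong₂ _+_ (sumBits-++ a b _) (sumBits-++ a b _)

sumBits-swap : ∀ a b (f : Vec Bool a → Vec Bool b → ℕ) →
               sumBits a (λ u → sumBits b (f u)) ≡ sumBits b (λ w → sumBits a (λ u → f u w))
sumBits-swap zero    b f = refl
sumBits-swap (suc a) b f = begin
  sumBits a (λ u → sumBits b (f (false ∷ u))) + sumBits a (λ u → sumBits b (f (true ∷ u)))
    ≡⟨ cong₂ _+_ (sumBits-swap a b _) (sumBits-swap a b _) ⟩
  sumBits b (λ w → sumBits a (λ u → f (false ∷ u) w)) + sumBits b (λ w → sumBits a (λ u → f (true ∷ u) w))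
    ≡⟨ sumBits-+ b _ _ ⟨
  sumBits b (λ w → sumBits (suc a) (λ u → f u w)) ∎
  where open ≡-Reasoning

sumBits-take-drop-* : ∀ a b (f : Vec Bool a → ℕ) (g : Vec Bool b → ℕ) →
                      sumBits (a + b) (λ v → f (take a v) * g (drop a v)) ≡ sumBits a f * sumBits b g
sumBits-take-drop-* a b f g = begin
  sumBits (a + b) (λ v → f (take a v) * g (drop a v))
    ≡⟨ sumBits-++ a b _ ⟩
  sumBits a (λ u → sumBits b (λ w → f (take a (u ++ w)) * g (drop a (u ++ w))))
    ≡⟨ sumBits-cong a (λ u → sumBits-cong b (λ w → cong₂ _*_ (cong f (take-++ u w)) (cong g (drop-++ u w)))) ⟩
  sumBits a (λ u → sumBits b (λ w → f u * g w))
    ≡⟨ sumBits-cong a (λ u → sumBits-*ˡ b (f u) g) ⟩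
  sumBits a (λ u → f u * sumBits b g)
    ≡⟨ sumBits-cong a (λ u → *-comm (f u) (sumBits b g)) ⟩
  sumBits a (λ u → sumBits b g * f u)
    ≡⟨ sumBits-*ˡ a (sumBits b g) f ⟩
  sumBits b g * sumBits a f
    ≡⟨ *-comm (sumBits b g) (sumBits a f) ⟩
  sumBits a f * sumBits b g ∎
  where open ≡-Reasoning

≤-sumBits : ∀ ℓ (f : Vec Bool ℓ → ℕ) v → f v ≤ sumBits ℓ f
≤-sumBits zero    f []          = ≤-refl
≤-sumBits (suc ℓ) f (false ∷ v) = ≤-trans (≤-sumBits ℓ (λ w → f (false ∷ w)) v) (m≤m+n _ _)
≤-sumBits (suc ℓ) f (true ∷ v)  = ≤-trans (≤-sumBits ℓ (λ w → f (true ∷ w)) v) (m≤n+m _ _)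

sumBits-*-≤ : ∀ ℓ (f : Vec Bool ℓ → ℕ) c d → (∀ v → f v * c ≤ d) → sumBits ℓ f * c ≤ 2 ^ ℓ * d
sumBits-*-≤ ℓ f c d fc≤d = begin
  sumBits ℓ f * c        ≡⟨ *-comm (sumBits ℓ f) c ⟩
  c * sumBits ℓ f        ≡⟨ sumBits-*ˡ ℓ c f ⟨
  sumBits ℓ (λ v → c * f v) ≤⟨ sumBits-mono ℓ (λ v → ≤-trans (≤-reflexive (*-comm c (f v))) (fc≤d v)) ⟩
  sumBits ℓ (λ _ → d)    ≡⟨ sumBits-const ℓ d ⟩
  2 ^ ℓ * d              ∎
  where open ≤-Reasoning

sumBits-≤⇒∃ : ∀ ℓ (f : Vec Bool ℓ → ℕ) c → sumBits ℓ f ≤ 2 ^ ℓ * c → Σ (Vec Bool ℓ) λ v → f v ≤ c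
sumBits-≤⇒∃ zero f c Σf≤ = [] , subst (f [] ≤_) (+-identityʳ c) Σf≤
sumBits-≤⇒∃ (suc ℓ) f c Σf≤ with sumBits ℓ (λ v → f (false ∷ v)) ≤? 2 ^ ℓ * c
... | yes f₀≤ = let (v , fv≤c) = sumBits-≤⇒∃ ℓ _ c f₀≤ in false ∷ v , fv≤c
... | no  f₀≰ = let (v , fv≤c) = sumBits-≤⇒∃ ℓ _ c f₁≤ in true ∷ v , fv≤c
  where
  f₁≤ : sumBits ℓ (λ v → f (true ∷ v)) ≤ 2 ^ ℓ * c
  f₁≤ = +-cancelˡ-≤ (2 ^ ℓ * c) _ _ (begin
    2 ^ ℓ * c + sumBits ℓ (λ v → f (true ∷ v)) ≤⟨ +-monoˡ-≤ _ (<⇒≤ (≰⇒> f₀≰)) ⟩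
    sumBits (suc ℓ) f                          ≤⟨ Σf≤ ⟩
    (2 ^ ℓ + (2 ^ ℓ + 0)) * c                  ≡⟨ cong (λ z → (2 ^ ℓ + z) * c) (+-identityʳ (2 ^ ℓ)) ⟩
    (2 ^ ℓ + 2 ^ ℓ) * c                        ≡⟨ *-distribʳ-+ c (2 ^ ℓ) (2 ^ ℓ) ⟩
    2 ^ ℓ * c + 2 ^ ℓ * c                      ∎)
    where open ≤-Reasoning

majority-of-complement : ∀ ℓ (p : Vec Bool ℓ → Bool) → 3 * countBits ℓ p ≤ 2 ^ ℓ →
                         2 * 2 ^ ℓ ≤ 3 * countBits ℓ (λ v → not (p v))
majority-of-complement ℓ p 3p≤ = +-cancelʳ-≤ (3 * countBits ℓ p) _ _ (begin
  2 * 2 ^ ℓ + 3 * countBits ℓ p                        ≤⟨ +-monoʳ-≤ (2 * 2 ^ ℓ) 3p≤ ⟩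
  2 * 2 ^ ℓ + 2 ^ ℓ                                    ≡⟨ cong (2 * 2 ^ ℓ +_) (*-identityˡ (2 ^ ℓ)) ⟨
  2 * 2 ^ ℓ + 1 * 2 ^ ℓ                                ≡⟨ *-distribʳ-+ (2 ^ ℓ) 2 1 ⟨
  3 * 2 ^ ℓ                                            ≡⟨ cong (3 *_) (countBits+countBits-not ℓ p) ⟨
  3 * (countBits ℓ p + countBits ℓ (λ v → not (p v)))  ≡⟨ *-distribˡ-+ 3 (countBits ℓ p) _ ⟩
  3 * countBits ℓ p + 3 * countBits ℓ (λ v → not (p v)) ≡⟨ +-comm (3 * countBits ℓ p) _ ⟩
  3 * countBits ℓ (λ v → not (p v)) + 3 * countBits ℓ p ∎)
  where open ≤-Reasoning

==-refl : ∀ a → (a == a) ≡ true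
==-refl a = cong not (xor-same a)

_==ᵛ_ : ∀ {ℓ} → Vec Bool ℓ → Vec Bool ℓ → Bool
[]       ==ᵛ []       = true
(a ∷ as) ==ᵛ (b ∷ bs) = (a == b) ∧ (as ==ᵛ bs)

==ᵛ-refl : ∀ {ℓ} (u : Vec Bool ℓ) → (u ==ᵛ u) ≡ true
==ᵛ-refl []      = refl
==ᵛ-refl (a ∷ u) rewrite ==-refl a = ==ᵛ-refl u

==ᵛ⇒≡ : ∀ {ℓ} (u w : Vec Bool ℓ) → (u ==ᵛ w) ≡ true → u ≡ w
==ᵛ⇒≡ []          []          _  = refl
==ᵛ⇒≡ (true ∷ u)  (true ∷ w)  eq = cong (true ∷_) (==ᵛ⇒≡ u w eq)
==ᵛ⇒≡ (false ∷ u) (false ∷ w) eq = cong (false ∷_) (==ᵛ⇒≡ u w eq)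

countBits-==ᵛ : ∀ ℓ (d : Vec Bool ℓ) → countBits ℓ (_==ᵛ d) ≡ 1
countBits-==ᵛ zero    []          = refl
countBits-==ᵛ (suc ℓ) (true ∷ d)  = cong₂ _+_ (countBits-false ℓ) (countBits-==ᵛ ℓ d)
countBits-==ᵛ (suc ℓ) (false ∷ d) = trans (cong₂ _+_ (countBits-==ᵛ ℓ d) (countBits-false ℓ)) refl

⌊⌋-true : ∀ {A : Set} (d : Dec A) → A → ⌊ d ⌋ ≡ true
⌊⌋-true d a = trans (isYes≗does d) (dec-true d a)

markov : ∀ ℓ (f : Vec Bool ℓ → ℕ) a b → countBits ℓ (λ j → not ⌊ a * f j ≤? b ⌋) * b ≤ a * sumBits ℓ f
markov ℓ f a b = begin
  countBits ℓ (λ j → not ⌊ a * f j ≤? b ⌋) * b       ≡⟨ *-comm _ b ⟩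
  b * countBits ℓ (λ j → not ⌊ a * f j ≤? b ⌋)       ≡⟨ sumBits-*ˡ ℓ b _ ⟨
  sumBits ℓ (λ j → b * 𝟙 (not ⌊ a * f j ≤? b ⌋))     ≤⟨ sumBits-mono ℓ (λ j → pointwise (a * f j)) ⟩
  sumBits ℓ (λ j → a * f j)                          ≡⟨ sumBits-*ˡ ℓ a f ⟩
  a * sumBits ℓ f                                    ∎
  where
  open ≤-Reasoning
  pointwise : ∀ c → b * 𝟙 (not ⌊ c ≤? b ⌋) ≤ c
  pointwise c with c ≤? b
  ... | yes _   = ≤-trans (≤-reflexive (*-zeroʳ b)) z≤n
  ... | no  c≰b = ≤-trans (≤-reflexive (*-identityʳ b)) (<⇒≤ (≰⇒> c≰b))

2^-reflects-≤ : ∀ a b → 2 ^ a ≤ 2 ^ b → a ≤ b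
2^-reflects-≤ a b 2^a≤2^b = ≮⇒≥ (λ b<a → <⇒≱ (^-monoʳ-< 2 (s≤s (s≤s z≤n)) b<a) 2^a≤2^b)

-- The upper bound: a hashing protocol

infix 8 _·_

_·_ : ∀ {m} → Vec Bool m → Vec Bool m → Bool
[]      · []      = false
(a ∷ r) · (b ∷ d) = (a ∧ b) xor (r · d)

xor-==-shift : ∀ c z s → ((c xor z) == s) ≡ (z == (c xor s))
xor-==-shift false z s = refl
xor-==-shift true  z s = cong not (trans (sym (not-distribˡ-xor z s)) (not-distribʳ-xor z s))

·-xor-∷ : ∀ {m} a (r : Vec Bool m) b b' e e' s →
          ((((a ∷ r) · (b ∷ e)) xor ((a ∷ r) · (b' ∷ e'))) == s)
          ≡ (((r · e) xor (r · e')) == ((a ∧ (b xor b')) xor s))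
·-xor-∷ a r b b' e e' s = begin
  (((a ∧ b) xor (r · e)) xor ((a ∧ b') xor (r · e'))) == s
    ≡⟨ cong (_== s) (xor-interchange (a ∧ b) (r · e) (a ∧ b') (r · e')) ⟩
  (((a ∧ b) xor (a ∧ b')) xor ((r · e) xor (r · e'))) == s
    ≡⟨ cong (λ c → (c xor ((r · e) xor (r · e'))) == s) (∧-distribˡ-xor a b b') ⟨
  ((a ∧ (b xor b')) xor ((r · e) xor (r · e'))) == s
    ≡⟨ xor-==-shift (a ∧ (b xor b')) _ s ⟩
  ((r · e) xor (r · e')) == ((a ∧ (b xor b')) xor s) ∎
  where open ≡-Reasoning

-- r ↦ (r · d) xor (r · d') is the nonzero linear form r ↦ r · (d xor d'), so it takes each
-- value on exactly half of {0,1}^m.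
·-balanced : ∀ {m} (d d' : Vec Bool m) → d ≢ d' → ∀ s →
             2 * countBits m (λ r → ((r · d) xor (r · d')) == s) ≡ 2 ^ m
·-balanced []      []        d≢d' s = ⊥-elim (d≢d' refl)
·-balanced {suc m} (b ∷ e) (b' ∷ e') d≢d' s with ≡-dec Bool._≟_ e e'
... | no e≢e' = begin
  2 * (countBits m (λ r → f (false ∷ r)) + countBits m (λ r → f (true ∷ r)))
    ≡⟨ *-distribˡ-+ 2 (countBits m (λ r → f (false ∷ r))) _ ⟩
  2 * countBits m (λ r → f (false ∷ r)) + 2 * countBits m (λ r → f (true ∷ r))
    ≡⟨ cong₂ _+_ (half false) (half true) ⟩
  2 ^ m + 2 ^ m
    ≡⟨ cong (2 ^ m +_) (+-identityʳ (2 ^ m)) ⟨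
  2 ^ suc m ∎
  where
  open ≡-Reasoning
  f : Vec Bool (suc m) → Bool
  f r = ((r · (b ∷ e)) xor (r · (b' ∷ e'))) == s
  half : ∀ a → 2 * countBits m (λ r → f (a ∷ r)) ≡ 2 ^ m
  half a = trans (cong (2 *_) (sumBits-cong m (λ r → cong 𝟙 (·-xor-∷ a r b b' e e' s))))
                 (·-balanced e e' e≢e' _)
... | yes refl = begin
  2 * (countBits m (λ r → f (false ∷ r)) + countBits m (λ r → f (true ∷ r)))
    ≡⟨ cong (λ z → 2 * z) (cong₂ _+_ (half false) (half true)) ⟩
  2 * (2 ^ m * 𝟙 (g false) + 2 ^ m * 𝟙 (g true))
    ≡⟨ cong (λ z → 2 * z) (*-distribˡ-+ (2 ^ m) (𝟙 (g false)) (𝟙 (g true))) ⟨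
  2 * (2 ^ m * (𝟙 (g false) + 𝟙 (g true)))
    ≡⟨ cong (λ z → 2 * (2 ^ m * z)) (one-of-two b b' (λ b≡b' → d≢d' (cong (_∷ e) b≡b'))) ⟩
  2 * (2 ^ m * 1)
    ≡⟨ cong (2 *_) (*-identityʳ (2 ^ m)) ⟩
  2 ^ suc m ∎
  where
  open ≡-Reasoning
  f : Vec Bool (suc m) → Bool
  f r = ((r · (b ∷ e)) xor (r · (b' ∷ e))) == s
  g : Bool → Bool
  g a = false == ((a ∧ (b xor b')) xor s)
  half : ∀ a → countBits m (λ r → f (a ∷ r)) ≡ 2 ^ m * 𝟙 (g a)
  half a = trans (sumBits-cong m (λ r → cong 𝟙 (trans (·-xor-∷ a r b b' e e s)
                                                      (cong (_== _) (xor-same (r · e))))))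
                 (sumBits-const m (𝟙 (g a)))
  one-of-two : ∀ b b' → b ≢ b' →
               𝟙 (false == ((false ∧ (b xor b')) xor s)) + 𝟙 (false == ((true ∧ (b xor b')) xor s)) ≡ 1
  one-of-two false false b≢b' = ⊥-elim (b≢b' refl)
  one-of-two true  true  b≢b' = ⊥-elim (b≢b' refl)
  one-of-two false true  _    = 𝟙+𝟙-not (not s)
  one-of-two true  false _    = 𝟙+𝟙-not (not s)

·-agree-count : ∀ {m} (d d' : Vec Bool m) → d ≢ d' → 2 * countBits m (λ r → (r · d) == (r · d')) ≡ 2 ^ m
·-agree-count {m} d d' d≢d' = trans
  (cong (2 *_) (sumBits-cong m (λ r → cong (λ z → 𝟙 (not z)) (sym (xor-identityʳ ((r · d) xor (r · d')))))))
  (·-balanced d d' d≢d' false)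

hash : ∀ k {m} → Vec Bool (k * m) → Vec Bool m → Vec Bool k
hash zero        M d = []
hash (suc k) {m} M d = (take m M · d) ∷ hash k (drop m M) d

hash-collisions : ∀ k {m} (d d' : Vec Bool m) → d ≢ d' →
                  2 ^ k * countBits (k * m) (λ M → hash k M d ==ᵛ hash k M d') ≡ 2 ^ (k * m)
hash-collisions zero        d d' d≢d' = refl
hash-collisions (suc k) {m} d d' d≢d' = begin
  2 ^ suc k * countBits (m + k * m) (λ M → hash (suc k) M d ==ᵛ hash (suc k) M d')
    ≡⟨ cong (2 ^ suc k *_) (sumBits-cong (m + k * m) (λ M → 𝟙-∧ (row M) (rest M))) ⟩
  2 ^ suc k * sumBits (m + k * m) (λ M → 𝟙 (row M) * 𝟙 (rest M))
    ≡⟨ cong (2 ^ suc k *_) (sumBits-take-drop-* m (k * m) _ _) ⟩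
  (2 * 2 ^ k) * (countBits m agree * countBits (k * m) (λ M → hash k M d ==ᵛ hash k M d'))
    ≡⟨ *-interchange 2 (2 ^ k) (countBits m agree) _ ⟩
  (2 * countBits m agree) * (2 ^ k * countBits (k * m) (λ M → hash k M d ==ᵛ hash k M d'))
    ≡⟨ cong₂ _*_ (·-agree-count d d' d≢d') (hash-collisions k d d' d≢d') ⟩
  2 ^ m * 2 ^ (k * m)
    ≡⟨ ^-distribˡ-+-* 2 m (k * m) ⟨
  2 ^ (m + k * m) ∎
  where
  open ≡-Reasoning
  agree : Vec Bool m → Bool
  agree r = (r · d) == (r · d')
  row rest : Vec Bool (m + k * m) → Bool
  row M = agree (take m M)
  rest M = hash k (drop m M) d ==ᵛ hash k (drop m M) d'

bit : Fin 2 → Bool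
bit zero       = false
bit (suc zero) = true

bit-injective : ∀ {i j} → bit i ≡ bit j → i ≡ j
bit-injective {zero}     {zero}     _ = refl
bit-injective {suc zero} {suc zero} _ = refl
bit-injective {zero}     {suc zero} ()
bit-injective {suc zero} {zero}     ()

bits : ∀ m → Fin (2 ^ m) → Vec Bool m
bits zero    i = []
bits (suc m) i = bit (proj₁ (remQuot {2} (2 ^ m) i)) ∷ bits m (proj₂ (remQuot {2} (2 ^ m) i))

bits-injective : ∀ m {i j} → bits m i ≡ bits m j → i ≡ j
bits-injective zero    {zero} {zero} _ = refl
bits-injective (suc m) {i}    {j}    eq = begin
  i                                  ≡⟨ combine-remQuot {2} (2 ^ m) i ⟨
  combine (proj₁ qrᵢ) (proj₂ qrᵢ)    ≡⟨ cong₂ combine (bit-injective (∷-injectiveˡ eq)) (bits-injective m (∷-injectiveʳ eq)) ⟩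
  combine (proj₁ qrⱼ) (proj₂ qrⱼ)    ≡⟨ combine-remQuot {2} (2 ^ m) j ⟩
  j                                  ∎
  where
  open ≡-Reasoning
  qrᵢ = remQuot {2} (2 ^ m) i
  qrⱼ = remQuot {2} (2 ^ m) j

support : ∀ {N} → Vec Bool N → List (Fin N)
support []           = []
support (true  ∷ bs) = zero ∷ List.map suc (support bs)
support (false ∷ bs) = List.map suc (support bs)

length-support : ∀ {N} (x : Vec Bool N) → length (support x) ≡ weight x
length-support []           = refl
length-support (true  ∷ bs) = cong suc (trans (length-map suc (support bs)) (length-support bs))
length-support (false ∷ bs) = trans (length-map suc (support bs)) (length-support bs)

any-support : ∀ {N} (x : Vec Bool N) ι (t : Fin N → Bool) →
              lookup x ι ≡ true → t ι ≡ true → any t (support x) ≡ true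
any-support (true  ∷ bs) zero    t _    tι = cong (_∨ any t (List.map suc (support bs))) tι
any-support (true  ∷ bs) (suc ι) t xι   tι =
  trans (cong (t zero ∨_) (trans (cong or (sym (map-∘ (support bs)))) (any-support bs ι (λ i → t (suc i)) xι tι)))
        (∨-zeroʳ (t zero))
any-support (false ∷ bs) (suc ι) t xι   tι =
  trans (cong or (sym (map-∘ (support bs)))) (any-support bs ι (λ i → t (suc i)) xι tι)

𝟙-any≤sum : ∀ {A : Set} (t : A → Bool) l → 𝟙 (any t l) ≤ sum (List.map (λ a → 𝟙 (t a)) l)
𝟙-any≤sum t []      = z≤n
𝟙-any≤sum t (a ∷ l) = ≤-trans (𝟙-∨ (t a) (any t l)) (+-monoʳ-≤ (𝟙 (t a)) (𝟙-any≤sum t l))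

sum-support-≤ : ∀ {N} (x : Vec Bool N) (f : Fin N → ℕ) D E → (∀ i → lookup x i ≡ true → D * f i ≤ E) →
                D * sum (List.map f (support x)) ≤ weight x * E
sum-support-≤ []           f D E bound = ≤-reflexive (*-zeroʳ D)
sum-support-≤ (true ∷ bs)  f D E bound = begin
  D * (f zero + sum (List.map f (List.map suc (support bs))))
    ≡⟨ cong (λ z → D * (f zero + z)) (cong sum (sym (map-∘ (support bs)))) ⟩
  D * (f zero + sum (List.map (λ i → f (suc i)) (support bs)))
    ≡⟨ *-distribˡ-+ D (f zero) _ ⟩
  D * f zero + D * sum (List.map (λ i → f (suc i)) (support bs))
    ≤⟨ +-mono-≤ (bound zero refl) (sum-support-≤ bs (λ i → f (suc i)) D E (λ i → bound (suc i))) ⟩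
  E + weight bs * E ∎
  where open ≤-Reasoning
sum-support-≤ (false ∷ bs) f D E bound = begin
  D * sum (List.map f (List.map suc (support bs)))
    ≡⟨ cong (D *_) (cong sum (sym (map-∘ (support bs)))) ⟩
  D * sum (List.map (λ i → f (suc i)) (support bs))
    ≤⟨ sum-support-≤ bs (λ i → f (suc i)) D E (λ i → bound (suc i)) ⟩
  weight bs * E ∎
  where open ≤-Reasoning

sumBits-sum : ∀ {A : Set} ℓ (f : Vec Bool ℓ → A → ℕ) l →
              sumBits ℓ (λ v → sum (List.map (f v) l)) ≡ sum (List.map (λ a → sumBits ℓ (λ v → f v a)) l)
sumBits-sum ℓ f []      = trans (sumBits-const ℓ 0) (*-zeroʳ (2 ^ ℓ))
sumBits-sum ℓ f (a ∷ l) = trans (sumBits-+ ℓ (λ v → f v a) _) (cong (sumBits ℓ (λ v → f v a) +_) (sumBits-sum ℓ f l))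

-- j slots of k+1 bits each: an occupancy flag followed by a payload.
module Slots (k : ℕ) where

  slots : ∀ j → List (Vec Bool k) → Vec Bool (j * suc k)
  slots zero    _        = []
  slots (suc j) []       = (false ∷ replicate k false) ++ slots j []
  slots (suc j) (h ∷ hs) = (true ∷ h) ++ slots j hs

  anySlot : ∀ j → (Vec Bool k → Bool) → Vec Bool (j * suc k) → Bool
  anySlot zero    t s = false
  anySlot (suc j) t (flag ∷ s) = (flag ∧ t (take k s)) ∨ anySlot j t (drop k s)

  anySlot-slots : ∀ j t (hs : List (Vec Bool k)) → length hs ≤ j → anySlot j t (slots j hs) ≡ any t hs
  anySlot-slots zero    t []       _ = refl
  anySlot-slots (suc j) t []       _
    rewrite drop-++ (replicate k false) (slots j [])
    = anySlot-slots j t [] z≤n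
  anySlot-slots (suc j) t (h ∷ hs) (s≤s len≤)
    rewrite take-++ h (slots j hs) | drop-++ h (slots j hs)
    = cong (t h ∨_) (anySlot-slots j t hs len≤)

n≤2^⌈log₂n⌉ : ∀ n → n ≤ 2 ^ ⌈log₂ n ⌉
n≤2^⌈log₂n⌉ = <-rec (λ n → n ≤ 2 ^ ⌈log₂ n ⌉) step
  where
  step : ∀ n → (∀ {m} → m < n → m ≤ 2 ^ ⌈log₂ m ⌉) → n ≤ 2 ^ ⌈log₂ n ⌉
  step zero          _   = z≤n
  step (suc zero)    _   = s≤s z≤n
  step (suc (suc n)) rec = begin
    N                               ≡⟨ ⌊n/2⌋+⌈n/2⌉≡n N ⟨
    ⌊ N /2⌋ + ⌈ N /2⌉               ≤⟨ +-monoˡ-≤ ⌈ N /2⌉ (⌊n/2⌋≤⌈n/2⌉ N) ⟩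
    ⌈ N /2⌉ + ⌈ N /2⌉               ≤⟨ +-mono-≤ half≤ half≤ ⟩
    2 ^ ℓ' + 2 ^ ℓ'                 ≡⟨ cong (2 ^ ℓ' +_) (+-identityʳ (2 ^ ℓ')) ⟨
    2 ^ suc ℓ'                      ≡⟨ cong (2 ^_) (trans (cong suc (⌈log₂⌈n/2⌉⌉≡⌈log₂n⌉∸1 N)) (m∸n+n≡m-suc)) ⟩
    2 ^ ⌈log₂ N ⌉                   ∎
    where
    open ≤-Reasoning
    N = suc (suc n)
    ℓ' = ⌈log₂ ⌈ N /2⌉ ⌉
    half≤ : ⌈ N /2⌉ ≤ 2 ^ ℓ'
    half≤ = rec (s≤s (s≤s (⌈n/2⌉≤n n)))
    m∸n+n≡m-suc : suc (⌈log₂ N ⌉ ∸ 1) ≡ ⌈log₂ N ⌉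
    m∸n+n≡m-suc = trans (+-comm 1 _) (m∸n+n≡m (⌈log₂⌉-mono-≤ {2} {N} (s≤s (s≤s z≤n))))

module HashingProtocol (m : ℕ) where

  k = ⌈log₂ m ⌉ + 2
  a = k * m
  open Slots k

  fingerprints : SparseX m → Vec Bool a → List (Vec Bool k)
  fingerprints x M = List.map (λ i → hash k M (bits m i)) (support (proj₁ x))

  protocol : OneWayProtocol (SparseX m) (SparseY m)
  protocol = record
    { alen  = a
    ; blen  = 0
    ; cost  = a + m * suc k
    ; alice = λ x M → M ++ slots m (fingerprints x M)
    ; bob   = λ ι _ msg → anySlot m (_==ᵛ hash k (take a msg) (bits m ι)) (drop a msg)
    }

  open OneWayProtocol protocol using (alice; bob)

  collides : Vec Bool a → Fin (2 ^ m) → Fin (2 ^ m) → Bool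
  collides M i ι = hash k M (bits m i) ==ᵛ hash k M (bits m ι)

  bob-alice : ∀ x ι M → bob ι [] (alice x M) ≡ any (λ i → collides M i ι) (support (proj₁ x))
  bob-alice x ι M rewrite take-++ M (slots m (fingerprints x M)) | drop-++ M (slots m (fingerprints x M)) =
    trans (anySlot-slots m _ (fingerprints x M) fingerprints≤m) (cong or (sym (map-∘ (support (proj₁ x)))))
    where
    fingerprints≤m : length (fingerprints x M) ≤ m
    fingerprints≤m = subst (_≤ m) (sym (trans (length-map _ (support (proj₁ x))) (length-support (proj₁ x)))) (proj₂ x)

  false-positives : (x : SparseX m) (ι : SparseY m) → lookup (proj₁ x) ι ≡ false →
                    3 * countBits a (λ M → any (λ i → collides M i ι) (support (proj₁ x))) ≤ 2 ^ a
  false-positives x ι xι≡false = *-cancelˡ-≤ (2 ^ k) {{m^n≢0 2 k}} (begin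
    2 ^ k * (3 * W)                         ≡⟨ x∙yz≈y∙xz (2 ^ k) 3 W ⟩
    3 * (2 ^ k * W)                         ≤⟨ *-monoʳ-≤ 3 (*-monoʳ-≤ (2 ^ k) union-bound) ⟩
    3 * (2 ^ k * sum (List.map c supp))     ≤⟨ *-monoʳ-≤ 3 (sum-support-≤ (proj₁ x) c (2 ^ k) (2 ^ a) collision-rate) ⟩
    3 * (weight (proj₁ x) * 2 ^ a)          ≤⟨ *-monoʳ-≤ 3 (*-monoˡ-≤ (2 ^ a) (proj₂ x)) ⟩
    3 * (m * 2 ^ a)                         ≡⟨ *-assoc 3 m (2 ^ a) ⟨
    (3 * m) * 2 ^ a                         ≤⟨ *-monoˡ-≤ (2 ^ a) 3m≤2^k ⟩
    2 ^ k * 2 ^ a                           ∎)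
    where
    open ≤-Reasoning
    supp = support (proj₁ x)
    W = countBits a (λ M → any (λ i → collides M i ι) supp)
    c : Fin (2 ^ m) → ℕ
    c i = countBits a (λ M → collides M i ι)
    union-bound : W ≤ sum (List.map c supp)
    union-bound = ≤-trans (sumBits-mono a (λ M → 𝟙-any≤sum _ supp))
                          (≤-reflexive (sumBits-sum a (λ M i → 𝟙 (collides M i ι)) supp))
    collision-rate : ∀ i → lookup (proj₁ x) i ≡ true → 2 ^ k * c i ≤ 2 ^ a
    collision-rate i xi≡true = ≤-reflexive (hash-collisions k (bits m i) (bits m ι) bits≢)
      where
      bits≢ : bits m i ≢ bits m ι
      bits≢ eq with bits-injective m eq
      ... | refl with trans (sym xi≡true) xι≡false
      ...   | ()
    3m≤2^k : 3 * m ≤ 2 ^ k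
    3m≤2^k = begin
      3 * m                  ≤⟨ *-monoˡ-≤ m (n≤1+n 3) ⟩
      4 * m                  ≤⟨ *-monoʳ-≤ 4 (n≤2^⌈log₂n⌉ m) ⟩
      4 * 2 ^ ⌈log₂ m ⌉      ≡⟨ *-comm 4 (2 ^ ⌈log₂ m ⌉) ⟩
      2 ^ ⌈log₂ m ⌉ * 2 ^ 2  ≡⟨ ^-distribˡ-+-* 2 ⌈log₂ m ⌉ 2 ⟨
      2 ^ k                  ∎

  correct : OneWayCorrect (SparseINDEX m) protocol
  correct x ι with lookup (proj₁ x) ι in xι
  ... | true = begin
    2 * (2 ^ a * 1)                                ≤⟨ *-monoˡ-≤ (2 ^ a * 1) (n≤1+n 2) ⟩
    3 * (2 ^ a * 1)                                ≡⟨ cong (3 *_) (sumBits-const a 1) ⟨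
    3 * countBits a (λ _ → true)                   ≡⟨ cong (3 *_) (sumBits-cong a (λ M → cong 𝟙 (sym (accepts M)))) ⟩
    3 * countBits a (λ M → bob ι [] (alice x M) == true) ∎
    where
    open ≤-Reasoning
    accepts : ∀ M → (bob ι [] (alice x M) == true) ≡ true
    accepts M rewrite bob-alice x ι M
                    | any-support (proj₁ x) ι (λ i → collides M i ι) xι (==ᵛ-refl (hash k M (bits m ι))) = refl
  ... | false = begin
    2 * (2 ^ a * 1)                                ≡⟨ cong (2 *_) (*-identityʳ (2 ^ a)) ⟩
    2 * 2 ^ a                                      ≤⟨ majority-of-complement a _ (false-positives x ι xι) ⟩
    3 * countBits a (λ M → not (any (λ i → collides M i ι) (support (proj₁ x))))
      ≡⟨ cong (3 *_) (sumBits-cong a (λ M →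
           cong (λ z → 𝟙 (not z)) (trans (sym (bob-alice x ι M)) (sym (xor-identityʳ _))))) ⟩
    3 * countBits a (λ M → bob ι [] (alice x M) == false) ∎
    where open ≤-Reasoning

  cost-≤ : 2 ≤ m → OneWayProtocol.cost protocol ≤ 7 * (m * ⌈log₂ m ⌉)
  cost-≤ m≥2 = begin
    k * m + m * suc k      ≡⟨ expand ⌈log₂ m ⌉ m ⟩
    m * (2 * ℓ + 5)        ≤⟨ *-monoʳ-≤ m (+-monoʳ-≤ (2 * ℓ) (*-monoʳ-≤ 5 (⌈log₂⌉-mono-≤ {2} {m} m≥2))) ⟩
    m * (2 * ℓ + 5 * ℓ)    ≡⟨ collect m ℓ ⟩
    7 * (m * ℓ)            ∎
    where
    open ≤-Reasoning
    ℓ = ⌈log₂ m ⌉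
    expand : ∀ ℓ m → (ℓ + 2) * m + m * suc (ℓ + 2) ≡ m * (2 * ℓ + 5)
    expand = solve-∀
    collect : ∀ m ℓ → m * (2 * ℓ + 5 * ℓ) ≡ 7 * (m * ℓ)
    collect = solve-∀

one-way-upper-bound : ∃[ C ] ∃[ M₀ ] ((m : ℕ) → M₀ ≤ m →
                      Σ (OneWayProtocol (SparseX m) (SparseY m)) λ P →
                        OneWayCorrect (SparseINDEX m) P × OneWayProtocol.cost P ≤ C * (m * ⌈log₂ m ⌉))
one-way-upper-bound = 7 , 2 , λ m m≥2 →
  HashingProtocol.protocol m , HashingProtocol.correct m , HashingProtocol.cost-≤ m m≥2

anyBits : ∀ ℓ → (Vec Bool ℓ → Bool) → Bool
anyBits zero    q = q []
anyBits (suc ℓ) q = anyBits ℓ (λ v → q (false ∷ v)) ∨ anyBits ℓ (λ v → q (true ∷ v))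

allBits : ∀ ℓ → (Vec Bool ℓ → Bool) → Bool
allBits zero    q = q []
allBits (suc ℓ) q = allBits ℓ (λ v → q (false ∷ v)) ∧ allBits ℓ (λ v → q (true ∷ v))

findBits : ∀ ℓ → (Vec Bool ℓ → Bool) → Vec Bool ℓ
findBits zero    q = []
findBits (suc ℓ) q =
  if anyBits ℓ (λ v → q (false ∷ v))
  then false ∷ findBits ℓ (λ v → q (false ∷ v))
  else true  ∷ findBits ℓ (λ v → q (true ∷ v))

anyBits-intro : ∀ ℓ q (w : Vec Bool ℓ) → q w ≡ true → anyBits ℓ q ≡ true
anyBits-intro zero    q []          qw = qw
anyBits-intro (suc ℓ) q (false ∷ w) qw = cong (_∨ anyBits ℓ (λ v → q (true ∷ v))) (anyBits-intro ℓ _ w qw)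
anyBits-intro (suc ℓ) q (true  ∷ w) qw =
  trans (cong (anyBits ℓ (λ v → q (false ∷ v)) ∨_) (anyBits-intro ℓ _ w qw)) (∨-zeroʳ _)

findBits-correct : ∀ ℓ q → anyBits ℓ q ≡ true → q (findBits ℓ q) ≡ true
findBits-correct zero    q any-q = any-q
findBits-correct (suc ℓ) q any-q with anyBits ℓ (λ v → q (false ∷ v)) in any-q₀
... | true  = findBits-correct ℓ _ any-q₀
... | false = findBits-correct ℓ _ any-q

𝟙-anyBits≤countBits : ∀ ℓ q → 𝟙 (anyBits ℓ q) ≤ countBits ℓ q
𝟙-anyBits≤countBits zero    q = ≤-refl
𝟙-anyBits≤countBits (suc ℓ) q = ≤-trans (𝟙-∨ (anyBits ℓ (λ v → q (false ∷ v))) _)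
  (+-mono-≤ (𝟙-anyBits≤countBits ℓ (λ v → q (false ∷ v))) (𝟙-anyBits≤countBits ℓ (λ v → q (true ∷ v))))

allBits-elim : ∀ ℓ q → allBits ℓ q ≡ true → ∀ j → q j ≡ true
allBits-elim zero    q all-q []          = all-q
allBits-elim (suc ℓ) q all-q (false ∷ j) = allBits-elim ℓ _ (∧-conicalˡ _ _ all-q) j
allBits-elim (suc ℓ) q all-q (true  ∷ j) = allBits-elim ℓ _ (∧-conicalʳ _ _ all-q) j

allBits-intro : ∀ ℓ q → (∀ j → q j ≡ true) → allBits ℓ q ≡ true
allBits-intro zero    q qj = qj []
allBits-intro (suc ℓ) q qj =
  cong₂ _∧_ (allBits-intro ℓ _ (λ j → qj (false ∷ j))) (allBits-intro ℓ _ (λ j → qj (true ∷ j)))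

𝟙-not-allBits≤countBits : ∀ ℓ q → 𝟙 (not (allBits ℓ q)) ≤ countBits ℓ (λ j → not (q j))
𝟙-not-allBits≤countBits zero    q = ≤-refl
𝟙-not-allBits≤countBits (suc ℓ) q = ≤-trans (𝟙-not-∧ (allBits ℓ (λ v → q (false ∷ v))) _)
  (+-mono-≤ (𝟙-not-allBits≤countBits ℓ (λ v → q (false ∷ v))) (𝟙-not-allBits≤countBits ℓ (λ v → q (true ∷ v))))

prodBits : ∀ ℓ → (Vec Bool ℓ → ℕ) → ℕ
prodBits zero    f = f []
prodBits (suc ℓ) f = prodBits ℓ (λ v → f (false ∷ v)) * prodBits ℓ (λ v → f (true ∷ v))

prodBits-mono : ∀ ℓ {f g : Vec Bool ℓ → ℕ} → (∀ v → f v ≤ g v) → prodBits ℓ f ≤ prodBits ℓ g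
prodBits-mono zero    f≤g = f≤g []
prodBits-mono (suc ℓ) f≤g =
  *-mono-≤ (prodBits-mono ℓ (λ v → f≤g (false ∷ v))) (prodBits-mono ℓ (λ v → f≤g (true ∷ v)))

prodBits-if : ∀ ℓ (D : Vec Bool ℓ → Bool) c →
              prodBits ℓ (λ j → if D j then 1 else c) * c ^ countBits ℓ D ≡ c ^ 2 ^ ℓ
prodBits-if zero D c with D []
... | true  = +-identityʳ (c * 1)
... | false = refl
prodBits-if (suc ℓ) D c = begin
  (P₀ * P₁) * c ^ (N₀ + N₁)       ≡⟨ cong ((P₀ * P₁) *_) (^-distribˡ-+-* c N₀ N₁) ⟩
  (P₀ * P₁) * (c ^ N₀ * c ^ N₁)   ≡⟨ *-interchange P₀ P₁ (c ^ N₀) (c ^ N₁) ⟩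
  (P₀ * c ^ N₀) * (P₁ * c ^ N₁)   ≡⟨ cong₂ _*_ (prodBits-if ℓ _ c) (prodBits-if ℓ _ c) ⟩
  c ^ 2 ^ ℓ * c ^ 2 ^ ℓ           ≡⟨ ^-distribˡ-+-* c (2 ^ ℓ) (2 ^ ℓ) ⟨
  c ^ (2 ^ ℓ + 2 ^ ℓ)             ≡⟨ cong (λ z → c ^ (2 ^ ℓ + z)) (+-identityʳ (2 ^ ℓ)) ⟨
  c ^ 2 ^ suc ℓ                   ∎
  where
  open ≡-Reasoning
  P₀ = prodBits ℓ (λ j → if D (false ∷ j) then 1 else c)
  P₁ = prodBits ℓ (λ j → if D (true ∷ j) then 1 else c)
  N₀ = countBits ℓ (λ j → D (false ∷ j))
  N₁ = countBits ℓ (λ j → D (true ∷ j))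

prodBits-const : ∀ ℓ c → prodBits ℓ (λ _ → c) ≡ c ^ 2 ^ ℓ
prodBits-const ℓ c = begin
  prodBits ℓ (λ _ → c)                               ≡⟨ *-identityʳ _ ⟨
  prodBits ℓ (λ _ → c) * c ^ 0                       ≡⟨ cong (λ z → prodBits ℓ (λ _ → c) * c ^ z) (countBits-false ℓ) ⟨
  prodBits ℓ (λ _ → c) * c ^ countBits ℓ (λ _ → false) ≡⟨ prodBits-if ℓ (λ _ → false) c ⟩
  c ^ 2 ^ ℓ                                          ∎
  where open ≡-Reasoning

-- sumFun L F is the sum of F over all functions {0,1}^L → {0,1}^n.
module FunctionSums (n : ℕ) where

  Fun : ℕ → Set
  Fun L = Vec Bool L → Vec Bool n

  join : ∀ {L} → Fun L → Fun L → Fun (suc L)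
  join g₀ g₁ (false ∷ j) = g₀ j
  join g₀ g₁ (true  ∷ j) = g₁ j

  sumFun : ∀ L → (Fun L → ℕ) → ℕ
  sumFun zero    F = sumBits n (λ u → F (λ _ → u))
  sumFun (suc L) F = sumFun L (λ g₀ → sumFun L (λ g₁ → F (join g₀ g₁)))

  sumFun-cong : ∀ L {F H : Fun L → ℕ} → (∀ g → F g ≡ H g) → sumFun L F ≡ sumFun L H
  sumFun-cong zero    F≡H = sumBits-cong n (λ u → F≡H _)
  sumFun-cong (suc L) F≡H = sumFun-cong L (λ g₀ → sumFun-cong L (λ g₁ → F≡H _))

  sumFun-mono : ∀ L {F H : Fun L → ℕ} → (∀ g → F g ≤ H g) → sumFun L F ≤ sumFun L H
  sumFun-mono zero    F≤H = sumBits-mono n (λ u → F≤H _)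
  sumFun-mono (suc L) F≤H = sumFun-mono L (λ g₀ → sumFun-mono L (λ g₁ → F≤H _))

  sumFun-*ˡ : ∀ L c (F : Fun L → ℕ) → sumFun L (λ g → c * F g) ≡ c * sumFun L F
  sumFun-*ˡ zero    c F = sumBits-*ˡ n c _
  sumFun-*ˡ (suc L) c F = trans (sumFun-cong L (λ g₀ → sumFun-*ˡ L c _)) (sumFun-*ˡ L c _)

  sumFun-+ : ∀ L (F H : Fun L → ℕ) → sumFun L (λ g → F g + H g) ≡ sumFun L F + sumFun L H
  sumFun-+ zero    F H = sumBits-+ n _ _
  sumFun-+ (suc L) F H = trans (sumFun-cong L (λ g₀ → sumFun-+ L (λ g₁ → F (join g₀ g₁)) (λ g₁ → H (join g₀ g₁))))
                               (sumFun-+ L _ _)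

  sumFun-sumBits : ∀ L ℓ (F : Fun L → Vec Bool ℓ → ℕ) →
                   sumFun L (λ g → sumBits ℓ (F g)) ≡ sumBits ℓ (λ r → sumFun L (λ g → F g r))
  sumFun-sumBits zero    ℓ F = sumBits-swap n ℓ _
  sumFun-sumBits (suc L) ℓ F = trans (sumFun-cong L (λ g₀ → sumFun-sumBits L ℓ (λ g₁ → F (join g₀ g₁))))
                                     (sumFun-sumBits L ℓ _)

  sumFun-* : ∀ L (F H : Fun L → ℕ) → sumFun L (λ g₀ → sumFun L (λ g₁ → F g₀ * H g₁)) ≡ sumFun L F * sumFun L H
  sumFun-* L F H = begin
    sumFun L (λ g₀ → sumFun L (λ g₁ → F g₀ * H g₁)) ≡⟨ sumFun-cong L (λ g₀ → sumFun-*ˡ L (F g₀) H) ⟩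
    sumFun L (λ g₀ → F g₀ * sumFun L H)             ≡⟨ sumFun-cong L (λ g₀ → *-comm (F g₀) (sumFun L H)) ⟩
    sumFun L (λ g₀ → sumFun L H * F g₀)             ≡⟨ sumFun-*ˡ L (sumFun L H) F ⟩
    sumFun L H * sumFun L F                         ≡⟨ *-comm (sumFun L H) (sumFun L F) ⟩
    sumFun L F * sumFun L H                         ∎
    where open ≡-Reasoning

  sumFun-allBits : ∀ L (C : Vec Bool L → Vec Bool n → Bool) →
                   sumFun L (λ g → 𝟙 (allBits L (λ j → C j (g j)))) ≡ prodBits L (λ j → countBits n (C j))
  sumFun-allBits zero    C = refl
  sumFun-allBits (suc L) C = begin
    sumFun L (λ g₀ → sumFun L (λ g₁ → 𝟙 (all₀ g₀ ∧ all₁ g₁)))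
      ≡⟨ sumFun-cong L (λ g₀ → sumFun-cong L (λ g₁ → 𝟙-∧ (all₀ g₀) (all₁ g₁))) ⟩
    sumFun L (λ g₀ → sumFun L (λ g₁ → 𝟙 (all₀ g₀) * 𝟙 (all₁ g₁)))
      ≡⟨ sumFun-* L _ _ ⟩
    sumFun L (λ g₀ → 𝟙 (all₀ g₀)) * sumFun L (λ g₁ → 𝟙 (all₁ g₁))
      ≡⟨ cong₂ _*_ (sumFun-allBits L (λ j → C (false ∷ j))) (sumFun-allBits L (λ j → C (true ∷ j))) ⟩
    prodBits (suc L) (λ j → countBits n (C j)) ∎
    where
    open ≡-Reasoning
    all₀ all₁ : Fun L → Bool
    all₀ g₀ = allBits L (λ j → C (false ∷ j) (g₀ j))
    all₁ g₁ = allBits L (λ j → C (true ∷ j) (g₁ j))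

  #Fun : ℕ → ℕ
  #Fun L = sumFun L (λ _ → 1)

  #Fun≡ : ∀ L → #Fun L ≡ (2 ^ n) ^ 2 ^ L
  #Fun≡ L = begin
    sumFun L (λ _ → 1)                                  ≡⟨ sumFun-cong L (λ _ → cong 𝟙 (allBits-intro L _ (λ _ → refl))) ⟨
    sumFun L (λ g → 𝟙 (allBits L (λ j → true)))        ≡⟨ sumFun-allBits L (λ _ _ → true) ⟩
    prodBits L (λ _ → countBits n (λ _ → true))         ≡⟨ cong (λ c → prodBits L (λ _ → c)) (countBits-true n) ⟩
    prodBits L (λ _ → 2 ^ n)                            ≡⟨ prodBits-const L (2 ^ n) ⟩
    (2 ^ n) ^ 2 ^ L                                     ∎
    where open ≡-Reasoning

-- The hard inputs: graphs of functions

tabulateBits : ∀ M → (Vec Bool M → Bool) → Vec Bool (2 ^ M)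
tabulateBits zero    f = f [] ∷ []
tabulateBits (suc M) f = tabulateBits M (λ w → f (false ∷ w)) ++ (tabulateBits M (λ w → f (true ∷ w)) ++ [])

index : ∀ M → Vec Bool M → Fin (2 ^ M)
index zero    []          = zero
index (suc M) (false ∷ w) = index M w ↑ˡ (2 ^ M + 0)
index (suc M) (true  ∷ w) = 2 ^ M ↑ʳ (index M w ↑ˡ 0)

lookup-tabulateBits : ∀ M f (w : Vec Bool M) → lookup (tabulateBits M f) (index M w) ≡ f w
lookup-tabulateBits zero    f []          = refl
lookup-tabulateBits (suc M) f (false ∷ w) =
  trans (lookup-++ˡ (tabulateBits M _) _ (index M w)) (lookup-tabulateBits M _ w)
lookup-tabulateBits (suc M) f (true  ∷ w) =
  trans (lookup-++ʳ (tabulateBits M _) _ (index M w ↑ˡ 0))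
        (trans (lookup-++ˡ (tabulateBits M _) [] (index M w)) (lookup-tabulateBits M _ w))

weight-++ : ∀ {a b} (xs : Vec Bool a) (ys : Vec Bool b) → weight (xs ++ ys) ≡ weight xs + weight ys
weight-++ []       ys = refl
weight-++ (x ∷ xs) ys = trans (cong (𝟙 x +_) (weight-++ xs ys)) (sym (+-assoc (𝟙 x) (weight xs) _))

weight-tabulateBits : ∀ M f → weight (tabulateBits M f) ≡ countBits M f
weight-tabulateBits zero    f = +-identityʳ _
weight-tabulateBits (suc M) f = begin
  weight (T₀ ++ (T₁ ++ []))           ≡⟨ weight-++ T₀ (T₁ ++ []) ⟩
  weight T₀ + weight (T₁ ++ [])       ≡⟨ cong (weight T₀ +_) (trans (weight-++ T₁ []) (+-identityʳ _)) ⟩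
  weight T₀ + weight T₁               ≡⟨ cong₂ _+_ (weight-tabulateBits M _) (weight-tabulateBits M _) ⟩
  countBits (suc M) f                 ∎
  where
  open ≡-Reasoning
  T₀ = tabulateBits M (λ w → f (false ∷ w))
  T₁ = tabulateBits M (λ w → f (true ∷ w))

module Graphs (L n : ℕ) (2^L≤L+n : 2 ^ L ≤ L + n) where

  graphIndicator : (Vec Bool L → Vec Bool n) → Vec Bool (L + n) → Bool
  graphIndicator g w = drop L w ==ᵛ g (take L w)

  weight-graph : ∀ g → weight (tabulateBits (L + n) (graphIndicator g)) ≡ 2 ^ L
  weight-graph g = begin
    weight (tabulateBits (L + n) (graphIndicator g))
      ≡⟨ weight-tabulateBits (L + n) (graphIndicator g) ⟩
    countBits (L + n) (graphIndicator g)
      ≡⟨ sumBits-++ L n _ ⟩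
    sumBits L (λ j → countBits n (λ u → graphIndicator g (j ++ u)))
      ≡⟨ sumBits-cong L (λ j → sumBits-cong n (λ u → cong 𝟙 (cong₂ (λ u' j' → u' ==ᵛ g j') (drop-++ j u) (take-++ j u)))) ⟩
    sumBits L (λ j → countBits n (_==ᵛ g j))
      ≡⟨ sumBits-cong L (λ j → countBits-==ᵛ n (g j)) ⟩
    countBits L (λ _ → true)
      ≡⟨ countBits-true L ⟩
    2 ^ L ∎
    where open ≡-Reasoning

  graph : (Vec Bool L → Vec Bool n) → SparseX (L + n)
  graph g = tabulateBits (L + n) (graphIndicator g) , subst (_≤ L + n) (sym (weight-graph g)) 2^L≤L+n

  query : Vec Bool L → Vec Bool n → SparseY (L + n)
  query j u = index (L + n) (j ++ u)

  SparseINDEX-graph : ∀ g j u → SparseINDEX (L + n) (graph g) (query j u) ≡ (u ==ᵛ g j)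
  SparseINDEX-graph g j u = trans (lookup-tabulateBits (L + n) (graphIndicator g) (j ++ u))
                                  (cong₂ (λ u' j' → u' ==ᵛ g j') (drop-++ j u) (take-++ j u))

-- Repetition and its tail bound

*-^ : ∀ a b s → (a * b) ^ s ≡ a ^ s * b ^ s
*-^ a b zero    = refl
*-^ a b (suc s) = begin
  (a * b) * (a * b) ^ s     ≡⟨ cong ((a * b) *_) (*-^ a b s) ⟩
  (a * b) * (a ^ s * b ^ s) ≡⟨ *-interchange a b (a ^ s) (b ^ s) ⟩
  (a * a ^ s) * (b * b ^ s) ∎
  where open ≡-Reasoning

𝟙-≤?-*-2^ : ∀ s c → 𝟙 ⌊ s ≤? c ⌋ * 2 ^ s ≤ 2 ^ c
𝟙-≤?-*-2^ s c with s ≤? c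
... | yes s≤c = ≤-trans (≤-reflexive (+-identityʳ (2 ^ s))) (^-monoʳ-≤ 2 s≤c)
... | no  _   = z≤n

𝟙-≤?-antitone : ∀ {a b} c → a ≤ b → 𝟙 ⌊ b ≤? c ⌋ ≤ 𝟙 ⌊ a ≤? c ⌋
𝟙-≤?-antitone {a} {b} c a≤b with b ≤? c | a ≤? c
... | yes _   | yes _   = ≤-refl
... | yes b≤c | no  a≰c = ⊥-elim (a≰c (≤-trans a≤b b≤c))
... | no  _   | _       = z≤n

module Repetition (R : ℕ) where

  successes : ∀ t → (Vec Bool R → Bool) → Vec Bool (t * R) → ℕ
  successes zero    p _  = 0
  successes (suc t) p rs = 𝟙 (p (take R rs)) + successes t p (drop R rs)

  successes+failures : ∀ t p rs → successes t p rs + successes t (λ r → not (p r)) rs ≡ t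
  successes+failures zero    p rs = refl
  successes+failures (suc t) p rs = begin
    (𝟙 b + successes t p rs') + (𝟙 (not b) + successes t (λ r → not (p r)) rs')
      ≡⟨ +-interchange (𝟙 b) (successes t p rs') (𝟙 (not b)) _ ⟩
    (𝟙 b + 𝟙 (not b)) + (successes t p rs' + successes t (λ r → not (p r)) rs')
      ≡⟨ cong₂ _+_ (𝟙+𝟙-not b) (successes+failures t p rs') ⟩
    suc t ∎
    where
    open ≡-Reasoning
    b = p (take R rs)
    rs' = drop R rs

  sumBits-2^successes : ∀ t p → sumBits (t * R) (λ rs → 2 ^ successes t p rs) ≡ (2 ^ R + countBits R p) ^ t
  sumBits-2^successes zero    p = refl
  sumBits-2^successes (suc t) p = begin
    sumBits (R + t * R) (λ rs → 2 ^ (𝟙 (p (take R rs)) + successes t p (drop R rs)))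
      ≡⟨ sumBits-cong (R + t * R) (λ rs → ^-distribˡ-+-* 2 (𝟙 (p (take R rs))) _) ⟩
    sumBits (R + t * R) (λ rs → 2 ^ 𝟙 (p (take R rs)) * 2 ^ successes t p (drop R rs))
      ≡⟨ sumBits-take-drop-* R (t * R) _ _ ⟩
    sumBits R (λ r → 2 ^ 𝟙 (p r)) * sumBits (t * R) (λ rs → 2 ^ successes t p rs)
      ≡⟨ cong₂ _*_ one-trial (sumBits-2^successes t p) ⟩
    (2 ^ R + countBits R p) * (2 ^ R + countBits R p) ^ t ∎
    where
    open ≡-Reasoning
    2^𝟙 : ∀ b → 2 ^ 𝟙 b ≡ 1 + 𝟙 b
    2^𝟙 true  = refl
    2^𝟙 false = refl
    one-trial : sumBits R (λ r → 2 ^ 𝟙 (p r)) ≡ 2 ^ R + countBits R p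
    one-trial = trans (sumBits-cong R (λ r → 2^𝟙 (p r)))
                      (trans (sumBits-+ R _ _) (cong (_+ countBits R p) (countBits-true R)))

  -- Markov's inequality applied to 2^successes.
  successes-tail : ∀ t s p →
    countBits (t * R) (λ rs → ⌊ s ≤? successes t p rs ⌋) * 2 ^ s ≤ (2 ^ R + countBits R p) ^ t
  successes-tail t s p = begin
    C * 2 ^ s                                              ≡⟨ *-comm C (2 ^ s) ⟩
    2 ^ s * C                                              ≡⟨ sumBits-*ˡ (t * R) (2 ^ s) _ ⟨
    sumBits (t * R) (λ rs → 2 ^ s * 𝟙 ⌊ s ≤? successes t p rs ⌋)
      ≤⟨ sumBits-mono (t * R) (λ rs → ≤-trans (≤-reflexive (*-comm (2 ^ s) _)) (𝟙-≤?-*-2^ s (successes t p rs))) ⟩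
    sumBits (t * R) (λ rs → 2 ^ successes t p rs)          ≡⟨ sumBits-2^successes t p ⟩
    (2 ^ R + countBits R p) ^ t                            ∎
    where
    open ≤-Reasoning
    C = countBits (t * R) (λ rs → ⌊ s ≤? successes t p rs ⌋)

  -- If p holds with probability at most 7/20, then p holds in at least half of 2s
  -- independent trials with probability at most (729/800)^s.
  majority-tail : ∀ s p → 20 * countBits R p ≤ 7 * 2 ^ R →
    countBits (2 * s * R) (λ rs → ⌊ s ≤? successes (2 * s) p rs ⌋) * 800 ^ s ≤ 729 ^ s * 2 ^ (2 * s * R)
  majority-tail s p density = begin
    C * 800 ^ s                              ≡⟨ cong (C *_) (*-^ 2 400 s) ⟩
    C * (2 ^ s * 400 ^ s)                    ≡⟨ *-assoc C (2 ^ s) (400 ^ s) ⟨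
    C * 2 ^ s * 400 ^ s                      ≤⟨ *-monoˡ-≤ (400 ^ s) (successes-tail (2 * s) s p) ⟩
    X ^ (2 * s) * 400 ^ s                    ≡⟨ cong (_* 400 ^ s) (^-*-assoc X 2 s) ⟨
    (X ^ 2) ^ s * 400 ^ s                    ≡⟨ *-^ (X ^ 2) 400 s ⟨
    (X ^ 2 * 400) ^ s                        ≡⟨ cong (_^ s) (square-20 X) ⟩
    ((20 * X) * (20 * X)) ^ s                ≤⟨ ^-monoˡ-≤ s (*-mono-≤ 20X≤ 20X≤) ⟩
    ((27 * 2 ^ R) * (27 * 2 ^ R)) ^ s        ≡⟨ cong (_^ s) (square-27 (2 ^ R)) ⟩
    (729 * (2 ^ R * 2 ^ R)) ^ s              ≡⟨ *-^ 729 (2 ^ R * 2 ^ R) s ⟩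
    729 ^ s * (2 ^ R * 2 ^ R) ^ s            ≡⟨ cong (λ z → 729 ^ s * z ^ s) (^-distribˡ-+-* 2 R R) ⟨
    729 ^ s * (2 ^ (R + R)) ^ s              ≡⟨ cong (729 ^ s *_) (^-*-assoc 2 (R + R) s) ⟩
    729 ^ s * 2 ^ ((R + R) * s)              ≡⟨ cong (λ z → 729 ^ s * 2 ^ z) (exponent R s) ⟩
    729 ^ s * 2 ^ (2 * s * R)                ∎
    where
    open ≤-Reasoning
    C = countBits (2 * s * R) (λ rs → ⌊ s ≤? successes (2 * s) p rs ⌋)
    X = 2 ^ R + countBits R p
    20X≤ : 20 * X ≤ 27 * 2 ^ R
    20X≤ = begin
      20 * X                             ≡⟨ *-distribˡ-+ 20 (2 ^ R) _ ⟩
      20 * 2 ^ R + 20 * countBits R p    ≤⟨ +-monoʳ-≤ (20 * 2 ^ R) density ⟩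
      20 * 2 ^ R + 7 * 2 ^ R             ≡⟨ *-distribʳ-+ (2 ^ R) 20 7 ⟨
      27 * 2 ^ R                         ∎
    square-20 : ∀ x → x * (x * 1) * 400 ≡ (20 * x) * (20 * x)
    square-20 = solve-∀
    square-27 : ∀ y → (27 * y) * (27 * y) ≡ 729 * (y * y)
    square-27 = solve-∀
    exponent : ∀ R s → (R + R) * s ≡ 2 * s * R
    exponent = solve-∀

-- The encoding argument

module Transcripts {X Y : Set} (P : OnlineMAProtocol X Y) where

  open OnlineMAProtocol P
  open Repetition rlen

  transcript : ∀ t → X → Vec Bool k₁ → Vec Bool (t * rlen) → Vec Bool (t * v)
  transcript zero    x w₁ rs = []
  transcript (suc t) x w₁ rs = alice x w₁ (take rlen rs) ++ transcript t x w₁ (drop rlen rs)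

  acceptances : ∀ t → Y → Vec Bool k₂ → Vec Bool (t * rlen) → Vec Bool (t * v) → ℕ
  acceptances zero    y w₂ rs μ = 0
  acceptances (suc t) y w₂ rs μ =
    𝟙 (bob y w₂ (take rlen rs) (take v μ)) + acceptances t y w₂ (drop rlen rs) (drop v μ)

  acceptances-transcript : ∀ t y w₂ x w₁ rs →
    acceptances t y w₂ rs (transcript t x w₁ rs) ≡ successes t (λ r → bob y w₂ r (alice x w₁ r)) rs
  acceptances-transcript zero    y w₂ x w₁ rs = refl
  acceptances-transcript (suc t) y w₂ x w₁ rs
    rewrite take-++ (alice x w₁ (take rlen rs)) (transcript t x w₁ (drop rlen rs))
          | drop-++ (alice x w₁ (take rlen rs)) (transcript t x w₁ (drop rlen rs))
    = cong (𝟙 (bob y w₂ (take rlen rs) (alice x w₁ (take rlen rs))) +_)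
           (acceptances-transcript t y w₂ x w₁ (drop rlen rs))

⅓⇒7/20 : ∀ c {N} → 3 * c ≤ N → 20 * c ≤ 7 * N
⅓⇒7/20 c {N} 3c≤N = begin
  20 * c       ≤⟨ *-monoˡ-≤ c (n≤1+n 20) ⟩
  21 * c       ≡⟨ *-assoc 7 3 c ⟩
  7 * (3 * c)  ≤⟨ *-monoʳ-≤ 7 3c≤N ⟩
  7 * N        ∎
  where open ≤-Reasoning

≤21*⇒/21≤ : ∀ {N d} → N ≤ 21 * d → N / 21 ≤ d
≤21*⇒/21≤ {N} {d} N≤21d = begin
  N / 21          ≤⟨ /-monoˡ-≤ 21 N≤21d ⟩
  21 * d / 21     ≡⟨ cong (_/ 21) (*-comm 21 d) ⟩
  d * 21 / 21     ≡⟨ m*n/n≡m d 21 ⟩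
  d               ∎
  where open ≤-Reasoning

module EncodingArgument (L n : ℕ) (2^L≤L+n : 2 ^ L ≤ L + n)
  (P : OnlineMAProtocol (SparseX (L + n)) (SparseY (L + n)))
  (correct : OnlineMACorrect (SparseINDEX (L + n)) P) (s : ℕ) where

  open OnlineMAProtocol P
  open Graphs L n 2^L≤L+n
  open FunctionSums n
  open Repetition rlen
  open Transcripts P

  t Z W : ℕ
  t = 2 * s
  Z = t * rlen
  W = t * v

  accepts : Vec Bool Z → Vec Bool W → Vec Bool L → Vec Bool n → Bool
  accepts rs μ j u = anyBits k₂ (λ w₂ → ⌊ suc s ≤? acceptances t (query j u) w₂ rs μ ⌋)

  decodable : Vec Bool Z → Vec Bool W → Vec Bool L → Bool
  decodable rs μ j = anyBits n (accepts rs μ j)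

  decode : Vec Bool Z → Vec Bool W → Vec Bool L → Vec Bool n
  decode rs μ j = findBits n (accepts rs μ j)

  a₀ : ℕ
  a₀ = 2 ^ L / 21

  consistent : Vec Bool Z → Vec Bool W → Fun L → Bool
  consistent rs μ g = allBits L (λ j → not (decodable rs μ j) ∨ (g j ==ᵛ decode rs μ j))
                      ∧ ⌊ a₀ ≤? countBits L (decodable rs μ) ⌋

  -- Knowing g on the a₀ decodable points leaves at most (2^n)^(2^L - a₀) candidates.
  count-consistent : ∀ rs μ → sumFun L (λ g → 𝟙 (consistent rs μ g)) * (2 ^ n) ^ a₀ ≤ (2 ^ n) ^ 2 ^ L
  count-consistent rs μ = by-cases (a₀ ≤? countBits L D)
    where
    open ≤-Reasoning
    D = decodable rs μ
    C : Vec Bool L → Vec Bool n → Bool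
    C j u = not (D j) ∨ (u ==ᵛ decode rs μ j)
    fibre : ∀ j → countBits n (C j) ≤ (if D j then 1 else 2 ^ n)
    fibre j with D j
    ... | true  = ≤-reflexive (countBits-==ᵛ n (decode rs μ j))
    ... | false = ≤-reflexive (countBits-true n)
    by-cases : (d : Dec (a₀ ≤ countBits L D)) →
               sumFun L (λ g → 𝟙 (allBits L (λ j → C j (g j)) ∧ ⌊ d ⌋)) * (2 ^ n) ^ a₀ ≤ (2 ^ n) ^ 2 ^ L
    by-cases (no _) = begin
      sumFun L (λ g → 𝟙 (allBits L (λ j → C j (g j)) ∧ false)) * (2 ^ n) ^ a₀
        ≡⟨ cong (_* (2 ^ n) ^ a₀) (sumFun-cong L (λ g → cong 𝟙 (∧-zeroʳ _))) ⟩
      sumFun L (λ _ → 0 * 0) * (2 ^ n) ^ a₀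
        ≡⟨ cong (_* (2 ^ n) ^ a₀) (sumFun-*ˡ L 0 (λ _ → 0)) ⟩
      0
        ≤⟨ z≤n ⟩
      (2 ^ n) ^ 2 ^ L ∎
    by-cases (yes a₀≤) = begin
      sumFun L (λ g → 𝟙 (allBits L (λ j → C j (g j)) ∧ true)) * (2 ^ n) ^ a₀
        ≡⟨ cong (_* (2 ^ n) ^ a₀) (sumFun-cong L (λ g → cong 𝟙 (∧-identityʳ _))) ⟩
      sumFun L (λ g → 𝟙 (allBits L (λ j → C j (g j)))) * (2 ^ n) ^ a₀
        ≡⟨ cong (_* (2 ^ n) ^ a₀) (sumFun-allBits L C) ⟩
      prodBits L (λ j → countBits n (C j)) * (2 ^ n) ^ a₀
        ≤⟨ *-mono-≤ (prodBits-mono L fibre) (^-monoʳ-≤ (2 ^ n) {{m^n≢0 2 n}} a₀≤) ⟩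
      prodBits L (λ j → if D j then 1 else 2 ^ n) * (2 ^ n) ^ countBits L D
        ≡⟨ prodBits-if L D (2 ^ n) ⟩
      (2 ^ n) ^ 2 ^ L ∎

  tailMass : ℕ
  tailMass = 729 ^ s * 2 ^ Z

  module ForFunction (g : Fun L) where

    x : SparseX (L + n)
    x = graph g

    y : Vec Bool L → SparseY (L + n)
    y j = query j (g j)

    rejections : Vec Bool L → Vec Bool mlen → ℕ
    rejections j rM = countBits rlen (λ rA → not (bob (y j) (h₂ x (y j) rM) rA (alice x (h₁ x rM) rA)))

    completeness-on-average : sumBits mlen (λ rM → sumBits L (λ j → 3 * rejections j rM)) ≤ 2 ^ mlen * (2 ^ L * 2 ^ rlen)
    completeness-on-average = begin
      sumBits mlen (λ rM → sumBits L (λ j → 3 * rejections j rM)) ≡⟨ sumBits-swap mlen L _ ⟩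
      sumBits L (λ j → sumBits mlen (λ rM → 3 * rejections j rM)) ≡⟨ sumBits-cong L (λ j → sumBits-*ˡ mlen 3 (rejections j)) ⟩
      sumBits L (λ j → 3 * sumBits mlen (rejections j))            ≤⟨ sumBits-mono L complete ⟩
      sumBits L (λ _ → 2 ^ mlen * 2 ^ rlen)                        ≡⟨ sumBits-const L _ ⟩
      2 ^ L * (2 ^ mlen * 2 ^ rlen)                                ≡⟨ x∙yz≈y∙xz (2 ^ L) (2 ^ mlen) (2 ^ rlen) ⟩
      2 ^ mlen * (2 ^ L * 2 ^ rlen)                                ∎
      where
      open ≤-Reasoning
      complete : ∀ j → 3 * sumBits mlen (rejections j) ≤ 2 ^ mlen * 2 ^ rlen
      complete j = proj₁ correct x (y j) (trans (SparseINDEX-graph g j (g j)) (==ᵛ-refl (g j)))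

    abstract
      rM : Vec Bool mlen
      rM = proj₁ (sumBits-≤⇒∃ mlen _ _ completeness-on-average)

      rM-rejections : sumBits L (λ j → 3 * rejections j rM) ≤ 2 ^ L * 2 ^ rlen
      rM-rejections = proj₂ (sumBits-≤⇒∃ mlen _ _ completeness-on-average)

    w₁ : Vec Bool k₁
    w₁ = h₁ x rM

    w₂ : Vec Bool L → Vec Bool k₂
    w₂ j = h₂ x (y j) rM

    reliable : Vec Bool L → Bool
    reliable j = ⌊ 20 * rejections j rM ≤? 7 * 2 ^ rlen ⌋

    many-reliable : 2 ^ L ≤ 21 * countBits L reliable
    many-reliable = +-cancelʳ-≤ (21 * N) _ _ (begin
      2 ^ L + 21 * N                         ≤⟨ +-monoʳ-≤ (2 ^ L) 21N≤ ⟩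
      2 ^ L + 20 * 2 ^ L                     ≡⟨ cong (_+ 20 * 2 ^ L) (*-identityˡ (2 ^ L)) ⟨
      1 * 2 ^ L + 20 * 2 ^ L                 ≡⟨ *-distribʳ-+ (2 ^ L) 1 20 ⟨
      21 * 2 ^ L                             ≡⟨ cong (21 *_) (countBits+countBits-not L reliable) ⟨
      21 * (countBits L reliable + N)        ≡⟨ *-distribˡ-+ 21 (countBits L reliable) N ⟩
      21 * countBits L reliable + 21 * N     ∎)
      where
      open ≤-Reasoning
      N = countBits L (λ j → not (reliable j))
      S = sumBits L (λ j → rejections j rM)
      rearrange : ∀ N r → 21 * N * r ≡ 3 * (N * (7 * r))
      rearrange = solve-∀
      21N*2^rlen≤ : 21 * N * 2 ^ rlen ≤ 20 * 2 ^ L * 2 ^ rlen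
      21N*2^rlen≤ = begin
        21 * N * 2 ^ rlen                          ≡⟨ rearrange N (2 ^ rlen) ⟩
        3 * (N * (7 * 2 ^ rlen))                   ≤⟨ *-monoʳ-≤ 3 (markov L (λ j → rejections j rM) 20 (7 * 2 ^ rlen)) ⟩
        3 * (20 * S)                               ≡⟨ x∙yz≈y∙xz 3 20 S ⟩
        20 * (3 * S)                               ≡⟨ cong (20 *_) (sumBits-*ˡ L 3 _) ⟨
        20 * sumBits L (λ j → 3 * rejections j rM) ≤⟨ *-monoʳ-≤ 20 rM-rejections ⟩
        20 * (2 ^ L * 2 ^ rlen)                    ≡⟨ *-assoc 20 (2 ^ L) (2 ^ rlen) ⟨
        20 * 2 ^ L * 2 ^ rlen                      ∎
      21N≤ : 21 * N ≤ 20 * 2 ^ L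
      21N≤ = *-cancelʳ-≤ (21 * N) (20 * 2 ^ L) (2 ^ rlen) {{m^n≢0 2 rlen}} 21N*2^rlen≤

    μ : Vec Bool Z → Vec Bool W
    μ rs = transcript t x w₁ rs

    accept-run : Vec Bool k₂ → Vec Bool L → Vec Bool n → Vec Bool rlen → Bool
    accept-run w j u r = bob (query j u) w r (alice x w₁ r)

    sound-at : Vec Bool L → Vec Bool n → Vec Bool Z → Bool
    sound-at j u rs = (u ==ᵛ g j) ∨ not (accepts rs (μ rs) j u)

    complete-at : Vec Bool L → Vec Bool Z → Bool
    complete-at j rs = not (reliable j) ∨ accepts rs (μ rs) j (g j)

    good : Vec Bool Z → Bool
    good rs = allBits L (λ j → allBits n (λ u → sound-at j u rs) ∧ complete-at j rs)

    accepts≤ : ∀ j u rs → 𝟙 (accepts rs (μ rs) j u) ≤ sumBits k₂ (λ w → 𝟙 ⌊ s ≤? successes t (accept-run w j u) rs ⌋)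
    accepts≤ j u rs = ≤-trans (𝟙-anyBits≤countBits k₂ _) (sumBits-mono k₂ (λ w →
      ≤-trans (≤-reflexive (cong (λ c → 𝟙 ⌊ suc s ≤? c ⌋) (acceptances-transcript t (query j u) w x w₁ rs)))
              (𝟙-≤?-antitone (successes t (accept-run w j u) rs) (n≤1+n s))))

    unsound-count : ∀ j u → countBits Z (λ rs → not ((u ==ᵛ g j) ∨ not (accepts rs (μ rs) j u))) * 800 ^ s
                            ≤ 2 ^ k₂ * tailMass
    unsound-count j u with u ==ᵛ g j in u≟gj
    ... | true  = ≤-trans (≤-reflexive (cong (_* 800 ^ s) (countBits-false Z))) z≤n
    ... | false = begin
      countBits Z (λ rs → not (not (accepts rs (μ rs) j u))) * 800 ^ s
        ≡⟨ cong (_* 800 ^ s) (sumBits-cong Z (λ rs → cong 𝟙 (not-involutive _))) ⟩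
      countBits Z (λ rs → accepts rs (μ rs) j u) * 800 ^ s
        ≤⟨ *-monoˡ-≤ (800 ^ s) (sumBits-mono Z (accepts≤ j u)) ⟩
      sumBits Z (λ rs → sumBits k₂ (λ w → 𝟙 ⌊ s ≤? successes t (accept-run w j u) rs ⌋)) * 800 ^ s
        ≡⟨ cong (_* 800 ^ s) (sumBits-swap Z k₂ _) ⟩
      sumBits k₂ (λ w → countBits Z (λ rs → ⌊ s ≤? successes t (accept-run w j u) rs ⌋)) * 800 ^ s
        ≤⟨ sumBits-*-≤ k₂ _ (800 ^ s) tailMass (λ w → majority-tail s (accept-run w j u) (sound w)) ⟩
      2 ^ k₂ * tailMass ∎
      where
      open ≤-Reasoning
      sound : ∀ w → 20 * countBits rlen (accept-run w j u) ≤ 7 * 2 ^ rlen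
      sound w = ⅓⇒7/20 (countBits rlen (accept-run w j u))
                         (proj₂ correct x (query j u) (trans (SparseINDEX-graph g j u) u≟gj) w₁ w)

    reject-run : Vec Bool L → Vec Bool rlen → Bool
    reject-run j r = not (accept-run (w₂ j) j (g j) r)

    -- If Bob, helped by w₂ j, accepts at most s of the 2s runs, he rejects at least s of them.
    rejects≤ : ∀ j rs → 𝟙 (not (accepts rs (μ rs) j (g j))) ≤ 𝟙 ⌊ s ≤? successes t (reject-run j) rs ⌋
    rejects≤ j rs with suc s ≤? successes t (accept-run (w₂ j) j (g j)) rs
    ... | yes s<acc = ≤-trans (≤-reflexive (cong (λ b → 𝟙 (not b)) (anyBits-intro k₂ _ (w₂ j) majority))) z≤n
      where
      majority : ⌊ suc s ≤? acceptances t (y j) (w₂ j) rs (μ rs) ⌋ ≡ true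
      majority = ⌊⌋-true (suc s ≤? acceptances t (y j) (w₂ j) rs (μ rs))
                          (subst (suc s ≤_) (sym (acceptances-transcript t (y j) (w₂ j) x w₁ rs)) s<acc)
    ... | no  s≮acc = ≤-trans (𝟙≤1 _) (≤-reflexive (cong 𝟙 (sym (⌊⌋-true (s ≤? rej) s≤rej))))
      where
      acc = successes t (accept-run (w₂ j) j (g j)) rs
      rej = successes t (reject-run j) rs
      s≤rej : s ≤ rej
      s≤rej = +-cancelˡ-≤ s s rej (begin
        s + s         ≡⟨ cong (s +_) (+-identityʳ s) ⟨
        t             ≡⟨ successes+failures t (accept-run (w₂ j) j (g j)) rs ⟨
        acc + rej     ≤⟨ +-monoˡ-≤ rej (s≤s⁻¹ (≰⇒> s≮acc)) ⟩
        s + rej       ∎)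
        where open ≤-Reasoning

    incomplete-count : ∀ j → countBits Z (λ rs → not (not (reliable j) ∨ accepts rs (μ rs) j (g j))) * 800 ^ s
                             ≤ tailMass
    incomplete-count j = by-cases (20 * rejections j rM ≤? 7 * 2 ^ rlen)
      where
      open ≤-Reasoning
      by-cases : (d : Dec (20 * rejections j rM ≤ 7 * 2 ^ rlen)) →
                 countBits Z (λ rs → not (not ⌊ d ⌋ ∨ accepts rs (μ rs) j (g j))) * 800 ^ s ≤ tailMass
      by-cases (no _)         = ≤-trans (≤-reflexive (cong (_* 800 ^ s) (countBits-false Z))) z≤n
      by-cases (yes reliable) = begin
        countBits Z (λ rs → not (accepts rs (μ rs) j (g j))) * 800 ^ s
          ≤⟨ *-monoˡ-≤ (800 ^ s) (sumBits-mono Z (rejects≤ j)) ⟩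
        countBits Z (λ rs → ⌊ s ≤? successes t (reject-run j) rs ⌋) * 800 ^ s
          ≤⟨ majority-tail s (reject-run j) reliable ⟩
        tailMass ∎

    bad-count-at : ∀ j → (sumBits n (λ u → countBits Z (λ rs → not (sound-at j u rs)))
                          + countBits Z (λ rs → not (complete-at j rs))) * 800 ^ s
                         ≤ 2 ^ n * (2 ^ k₂ * tailMass) + tailMass
    bad-count-at j = begin
      (U + I) * 800 ^ s            ≡⟨ *-distribʳ-+ (800 ^ s) U I ⟩
      U * 800 ^ s + I * 800 ^ s    ≤⟨ +-mono-≤ (sumBits-*-≤ n unsound (800 ^ s) _ (unsound-count j)) (incomplete-count j) ⟩
      2 ^ n * (2 ^ k₂ * tailMass) + tailMass ∎
      where
      open ≤-Reasoning
      unsound : Vec Bool n → ℕ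
      unsound u = countBits Z (λ rs → not (sound-at j u rs))
      U = sumBits n unsound
      I = countBits Z (λ rs → not (complete-at j rs))

    bad-count : countBits Z (λ rs → not (good rs)) * 800 ^ s ≤ 2 ^ L * (2 ^ n * (2 ^ k₂ * tailMass) + tailMass)
    bad-count = begin
      countBits Z (λ rs → not (good rs)) * 800 ^ s
        ≤⟨ *-monoˡ-≤ (800 ^ s) (sumBits-mono Z union-bound) ⟩
      sumBits Z (λ rs → sumBits L (λ j → unsound j rs + incomplete j rs)) * 800 ^ s
        ≡⟨ cong (_* 800 ^ s) exchange ⟩
      sumBits L (λ j → sumBits n (λ u → countBits Z (λ rs → not (sound-at j u rs)))
                       + countBits Z (λ rs → not (complete-at j rs))) * 800 ^ s
        ≤⟨ sumBits-*-≤ L _ (800 ^ s) _ bad-count-at ⟩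
      2 ^ L * (2 ^ n * (2 ^ k₂ * tailMass) + tailMass) ∎
      where
      open ≤-Reasoning
      unsound incomplete : Vec Bool L → Vec Bool Z → ℕ
      unsound j rs = countBits n (λ u → not (sound-at j u rs))
      incomplete j rs = 𝟙 (not (complete-at j rs))
      union-bound : ∀ rs → 𝟙 (not (good rs)) ≤ sumBits L (λ j → unsound j rs + incomplete j rs)
      union-bound rs = ≤-trans (𝟙-not-allBits≤countBits L _) (sumBits-mono L (λ j →
        ≤-trans (𝟙-not-∧ (allBits n (λ u → sound-at j u rs)) _)
                (+-monoˡ-≤ _ (𝟙-not-allBits≤countBits n (λ u → sound-at j u rs)))))
      exchange : sumBits Z (λ rs → sumBits L (λ j → unsound j rs + incomplete j rs))
               ≡ sumBits L (λ j → sumBits n (λ u → countBits Z (λ rs → not (sound-at j u rs)))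
                                  + countBits Z (λ rs → not (complete-at j rs)))
      exchange = trans (sumBits-swap Z L _) (sumBits-cong L (λ j →
        trans (sumBits-+ Z (unsound j) (incomplete j))
              (cong (_+ countBits Z (λ rs → not (complete-at j rs))) (sumBits-swap Z n _))))

    good-at : ∀ rs → good rs ≡ true → ∀ j → (allBits n (λ u → sound-at j u rs) ∧ complete-at j rs) ≡ true
    good-at rs good-rs = allBits-elim L (λ j → allBits n (λ u → sound-at j u rs) ∧ complete-at j rs) good-rs

    decoded-correctly : ∀ rs → good rs ≡ true → ∀ j → decodable rs (μ rs) j ≡ true → decode rs (μ rs) j ≡ g j
    decoded-correctly rs good-rs j decodable-j =
      ==ᵛ⇒≡ u (g j) (unless-rejected (u ==ᵛ g j) (accepts rs (μ rs) j u) sound-u accepted)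
      where
      u = decode rs (μ rs) j
      accepted : accepts rs (μ rs) j u ≡ true
      accepted = findBits-correct n (accepts rs (μ rs) j) decodable-j
      sound-u : sound-at j u rs ≡ true
      sound-u = allBits-elim n (λ u → sound-at j u rs)
                  (∧-conicalˡ (allBits n (λ u → sound-at j u rs)) (complete-at j rs) (good-at rs good-rs j)) u
      unless-rejected : ∀ a b → (a ∨ not b) ≡ true → b ≡ true → a ≡ true
      unless-rejected true  _    _ _ = refl
      unless-rejected false true () _

    reliable⇒accepted : ∀ rs → good rs ≡ true → ∀ j → reliable j ≡ true → accepts rs (μ rs) j (g j) ≡ true
    reliable⇒accepted rs good-rs j reliable-j = subst (λ b → (not b ∨ accepts rs (μ rs) j (g j)) ≡ true) reliable-j complete
      where
      complete : complete-at j rs ≡ true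
      complete = ∧-conicalʳ (allBits n (λ u → sound-at j u rs)) (complete-at j rs) (good-at rs good-rs j)

    good⇒consistent : ∀ rs → good rs ≡ true → consistent rs (μ rs) g ≡ true
    good⇒consistent rs good-rs = cong₂ _∧_ (allBits-intro L agrees agrees-everywhere) (⌊⌋-true (a₀ ≤? D) a₀≤D)
      where
      D = countBits L (decodable rs (μ rs))
      agrees : Vec Bool L → Bool
      agrees j = not (decodable rs (μ rs) j) ∨ (g j ==ᵛ decode rs (μ rs) j)
      agrees-everywhere : ∀ j → agrees j ≡ true
      agrees-everywhere j = not-∨-intro λ decodable-j →
        subst (λ u → (g j ==ᵛ u) ≡ true) (sym (decoded-correctly rs good-rs j decodable-j)) (==ᵛ-refl (g j))
      reliable⇒decodable : ∀ j → 𝟙 (reliable j) ≤ 𝟙 (decodable rs (μ rs) j)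
      reliable⇒decodable j = 𝟙-mono λ reliable-j → anyBits-intro n (accepts rs (μ rs) j) (g j) (reliable⇒accepted rs good-rs j reliable-j)
      a₀≤D : a₀ ≤ D
      a₀≤D = ≤21*⇒/21≤ (≤-trans many-reliable (*-monoʳ-≤ 21 (sumBits-mono L reliable⇒decodable)))

  module Counting (s-large : 2 * (2 ^ L * (2 ^ n * 2 ^ k₂ + 1)) * 729 ^ s ≤ 800 ^ s) where

    open ForFunction using (good; good⇒consistent)

    bad : Fun L → Vec Bool Z → Bool
    bad g rs = not (good g rs)

    mostly-good : ∀ g → 2 * countBits Z (bad g) ≤ 2 ^ Z
    mostly-good g = *-cancelʳ-≤ _ _ (800 ^ s) {{m^n≢0 800 s}} (begin
      2 * B * 800 ^ s                                         ≡⟨ *-assoc 2 B (800 ^ s) ⟩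
      2 * (B * 800 ^ s)                                       ≤⟨ *-monoʳ-≤ 2 (ForFunction.bad-count g) ⟩
      2 * (2 ^ L * (2 ^ n * (2 ^ k₂ * tailMass) + tailMass))  ≡⟨ factor 2 (2 ^ L) (2 ^ n) (2 ^ k₂) (729 ^ s) (2 ^ Z) ⟩
      2 * (2 ^ L * (2 ^ n * 2 ^ k₂ + 1)) * 729 ^ s * 2 ^ Z    ≤⟨ *-monoˡ-≤ (2 ^ Z) s-large ⟩
      800 ^ s * 2 ^ Z                                         ≡⟨ *-comm (800 ^ s) (2 ^ Z) ⟩
      2 ^ Z * 800 ^ s                                         ∎)
      where
      open ≤-Reasoning
      B = countBits Z (bad g)
      factor : ∀ a b c d e f → a * (b * (c * (d * (e * f)) + e * f)) ≡ a * (b * (c * d + 1)) * e * f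
      factor = solve-∀

    bad-on-average : sumBits Z (λ rs → sumFun L (λ g → 2 * 𝟙 (bad g rs))) ≤ 2 ^ Z * #Fun L
    bad-on-average = begin
      sumBits Z (λ rs → sumFun L (λ g → 2 * 𝟙 (bad g rs)))  ≡⟨ sumFun-sumBits L Z _ ⟨
      sumFun L (λ g → sumBits Z (λ rs → 2 * 𝟙 (bad g rs)))  ≡⟨ sumFun-cong L (λ g → sumBits-*ˡ Z 2 _) ⟩
      sumFun L (λ g → 2 * countBits Z (bad g))              ≤⟨ sumFun-mono L (λ g → ≤-trans (mostly-good g) (≤-reflexive (sym (*-identityʳ _)))) ⟩
      sumFun L (λ _ → 2 ^ Z * 1)                            ≡⟨ sumFun-*ˡ L (2 ^ Z) _ ⟩
      2 ^ Z * #Fun L                                        ∎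
      where open ≤-Reasoning

    abstract
      rs : Vec Bool Z
      rs = proj₁ (sumBits-≤⇒∃ Z _ (#Fun L) bad-on-average)

      rs-bad : sumFun L (λ g → 2 * 𝟙 (bad g rs)) ≤ #Fun L
      rs-bad = proj₂ (sumBits-≤⇒∃ Z _ (#Fun L) bad-on-average)

    #good #bad : ℕ
    #good = sumFun L (λ g → 𝟙 (good g rs))
    #bad  = sumFun L (λ g → 𝟙 (bad g rs))

    half-good : #Fun L ≤ 2 * #good
    half-good = +-cancelʳ-≤ (#Fun L) _ _ (begin
      #Fun L + #Fun L          ≡⟨ cong (#Fun L +_) (+-identityʳ (#Fun L)) ⟨
      2 * #Fun L               ≡⟨ cong (2 *_) good+bad ⟨
      2 * (#good + #bad)       ≡⟨ *-distribˡ-+ 2 #good #bad ⟩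
      2 * #good + 2 * #bad     ≤⟨ +-monoʳ-≤ (2 * #good) (≤-trans (≤-reflexive (sym (sumFun-*ˡ L 2 _))) rs-bad) ⟩
      2 * #good + #Fun L       ∎)
      where
      open ≤-Reasoning
      good+bad : #good + #bad ≡ #Fun L
      good+bad = trans (sym (sumFun-+ L _ _)) (sumFun-cong L (λ g → 𝟙+𝟙-not (good g rs)))

    good-encoded : #good * (2 ^ n) ^ a₀ ≤ 2 ^ W * #Fun L
    good-encoded = begin
      #good * (2 ^ n) ^ a₀
        ≤⟨ *-monoˡ-≤ ((2 ^ n) ^ a₀) (sumFun-mono L good≤consistent) ⟩
      sumFun L (λ g → countBits W (λ μ → consistent rs μ g)) * (2 ^ n) ^ a₀
        ≡⟨ cong (_* (2 ^ n) ^ a₀) (sumFun-sumBits L W _) ⟩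
      sumBits W (λ μ → sumFun L (λ g → 𝟙 (consistent rs μ g))) * (2 ^ n) ^ a₀
        ≤⟨ sumBits-*-≤ W _ ((2 ^ n) ^ a₀) _ (count-consistent rs) ⟩
      2 ^ W * (2 ^ n) ^ 2 ^ L
        ≡⟨ cong (2 ^ W *_) (#Fun≡ L) ⟨
      2 ^ W * #Fun L ∎
      where
      open ≤-Reasoning
      good≤consistent : ∀ g → 𝟙 (good g rs) ≤ countBits W (λ μ → consistent rs μ g)
      good≤consistent g with good g rs in good-g
      ... | false = z≤n
      ... | true  = ≤-trans (≤-reflexive (cong 𝟙 (sym (good⇒consistent g rs good-g))))
                            (≤-sumBits W _ (ForFunction.μ g rs))

    encoding-bound : n * a₀ ≤ 1 + W
    encoding-bound = 2^-reflects-≤ (n * a₀) (1 + W) (subst (_≤ 2 * 2 ^ W) (^-*-assoc 2 n a₀) few-values)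
      where
      open ≤-Reasoning
      instance
        #Fun≢0 : NonZero (#Fun L)
        #Fun≢0 = subst NonZero (sym (#Fun≡ L)) (m^n≢0 (2 ^ n) (2 ^ L) {{m^n≢0 2 n}})
      few-values : (2 ^ n) ^ a₀ ≤ 2 * 2 ^ W
      few-values = *-cancelˡ-≤ (#Fun L) (begin
        #Fun L * (2 ^ n) ^ a₀         ≤⟨ *-monoˡ-≤ ((2 ^ n) ^ a₀) half-good ⟩
        2 * #good * (2 ^ n) ^ a₀      ≡⟨ *-assoc 2 #good _ ⟩
        2 * (#good * (2 ^ n) ^ a₀)    ≤⟨ *-monoʳ-≤ 2 good-encoded ⟩
        2 * (2 ^ W * #Fun L)          ≡⟨ x∙yz≈z∙xy 2 (2 ^ W) (#Fun L) ⟩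
        #Fun L * (2 * 2 ^ W)          ∎)

-- The lower bound

n<2^n : ∀ n → n < 2 ^ n
n<2^n zero    = s≤s z≤n
n<2^n (suc n) = begin-strict
  suc n          <⟨ s≤s (n<2^n n) ⟩
  suc (2 ^ n)    ≤⟨ +-monoˡ-≤ (2 ^ n) (m^n>0 2 n) ⟩
  2 ^ n + 2 ^ n  ≡⟨ cong (2 ^ n +_) (+-identityʳ (2 ^ n)) ⟨
  2 ^ suc n      ∎
  where open ≤-Reasoning

2*n≤2^n : ∀ n → 2 * n ≤ 2 ^ n
2*n≤2^n zero    = z≤n
2*n≤2^n (suc n) = *-monoʳ-≤ 2 (n<2^n n)

power-of-two-bracket : ∀ m → 1 ≤ m → Σ ℕ λ L → 2 ^ L ≤ m × m < 2 * 2 ^ L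
power-of-two-bracket (suc zero)    _ = 0 , s≤s z≤n , s≤s (s≤s z≤n)
power-of-two-bracket (suc (suc m)) _ with power-of-two-bracket (suc m) (s≤s z≤n)
... | L , 2^L≤ , <2^L+1 with suc (suc m) <? 2 * 2 ^ L
...   | yes <2^L+1' = L , ≤-trans 2^L≤ (n≤1+n _) , <2^L+1'
...   | no  ≮2^L+1  = suc L , ≤-reflexive (sym m≡2^L+1) , subst (_< 2 * 2 ^ suc L) (sym m≡2^L+1) 2^L+1<2^L+2
  where
  m≡2^L+1 : suc (suc m) ≡ 2 * 2 ^ L
  m≡2^L+1 = ≤-antisym <2^L+1 (≮⇒≥ ≮2^L+1)
  2^L+1<2^L+2 : 2 * 2 ^ L < 2 * (2 * 2 ^ L)
  2^L+1<2^L+2 = *-monoʳ-< 2 (m<m+n (2 ^ L) (≤-trans (m^n>0 2 L) (m≤m+n (2 ^ L) 0)))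

≤21*[/21]+20 : ∀ N → N ≤ 21 * (N / 21) + 20
≤21*[/21]+20 N = begin
  N                        ≡⟨ m≡m%n+[m/n]*n N 21 ⟩
  N % 21 + N / 21 * 21     ≤⟨ +-monoˡ-≤ _ (s≤s⁻¹ (m%n<n N 21)) ⟩
  20 + N / 21 * 21         ≡⟨ +-comm 20 _ ⟩
  N / 21 * 21 + 20         ≡⟨ cong (_+ 20) (*-comm (N / 21) 21) ⟩
  21 * (N / 21) + 20       ∎
  where open ≤-Reasoning

-- 2 · 729^8 ≤ 800^8, so the failure probability (729/800)^s is tiny for s linear in L + n + k.
repetitions-suffice : ∀ L n k → let s = 8 * (L + n + k + 2) in
                      2 * (2 ^ L * (2 ^ n * 2 ^ k + 1)) * 729 ^ s ≤ 800 ^ s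
repetitions-suffice L n k = begin
  2 * (2 ^ L * (2 ^ n * 2 ^ k + 1)) * 729 ^ (8 * E)  ≤⟨ *-monoˡ-≤ (729 ^ (8 * E)) prefactor≤ ⟩
  2 ^ E * 729 ^ (8 * E)                              ≡⟨ cong (2 ^ E *_) (^-*-assoc 729 8 E) ⟨
  2 ^ E * (729 ^ 8) ^ E                              ≡⟨ *-^ 2 (729 ^ 8) E ⟨
  (2 * 729 ^ 8) ^ E                                  ≤⟨ ^-monoˡ-≤ E (≤ᵇ⇒≤ (2 * 729 ^ 8) (800 ^ 8) tt) ⟩
  (800 ^ 8) ^ E                                      ≡⟨ ^-*-assoc 800 8 E ⟩
  800 ^ (8 * E)                                      ∎
  where
  open ≤-Reasoning
  E = L + n + k + 2
  2^E≡ : 2 ^ E ≡ 2 * (2 ^ L * (2 ^ n * 2 ^ k + 2 ^ n * 2 ^ k))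
  2^E≡ = begin-equality
    2 ^ (L + n + k + 2)                     ≡⟨ ^-distribˡ-+-* 2 (L + n + k) 2 ⟩
    2 ^ (L + n + k) * 4                     ≡⟨ cong (_* 4) (^-distribˡ-+-* 2 (L + n) k) ⟩
    2 ^ (L + n) * 2 ^ k * 4                 ≡⟨ cong (λ z → z * 2 ^ k * 4) (^-distribˡ-+-* 2 L n) ⟩
    2 ^ L * 2 ^ n * 2 ^ k * 4               ≡⟨ regroup (2 ^ L) (2 ^ n) (2 ^ k) ⟩
    2 * (2 ^ L * (2 ^ n * 2 ^ k + 2 ^ n * 2 ^ k)) ∎
    where
    regroup : ∀ a b c → a * b * c * 4 ≡ 2 * (a * (b * c + b * c))
    regroup = solve-∀
  1≤2^n*2^k : 1 ≤ 2 ^ n * 2 ^ k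
  1≤2^n*2^k = subst (1 ≤_) (^-distribˡ-+-* 2 n k) (m^n>0 2 (n + k))
  prefactor≤ : 2 * (2 ^ L * (2 ^ n * 2 ^ k + 1)) ≤ 2 ^ E
  prefactor≤ = ≤-trans (*-monoʳ-≤ 2 (*-monoʳ-≤ (2 ^ L) (+-monoʳ-≤ (2 ^ n * 2 ^ k) 1≤2^n*2^k)))
                       (≤-reflexive (sym 2^E≡))

2^L≤L+n⇒L≤n : ∀ {L n} → 2 ^ L ≤ L + n → L ≤ n
2^L≤L+n⇒L≤n {L} {n} 2^L≤L+n = +-cancelˡ-≤ L L n (begin
  L + L       ≡⟨ cong (L +_) (+-identityʳ L) ⟨
  2 * L       ≤⟨ 2*n≤2^n L ⟩
  2 ^ L       ≤⟨ 2^L≤L+n ⟩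
  L + n       ∎)
  where open ≤-Reasoning

square-bound : ∀ m n a c → 0 < m → m ≤ 2 * n → m ≤ 42 * a + 40 →
               n * a ≤ 33 * (m * c) → n ≤ m * c → m ≤ 3000 * c
square-bound m n a c 0<m m≤2n m≤42a+40 na≤ n≤mc = *-cancelˡ-≤ m {{>-nonZero 0<m}} (begin
  m * m                              ≤⟨ *-mono-≤ m≤2n m≤42a+40 ⟩
  (2 * n) * (42 * a + 40)            ≡⟨ expand n a ⟩
  84 * (n * a) + 80 * n              ≤⟨ +-mono-≤ (*-monoʳ-≤ 84 na≤) (*-monoʳ-≤ 80 n≤mc) ⟩
  84 * (33 * (m * c)) + 80 * (m * c) ≡⟨ collect m c ⟩
  m * (2852 * c)                     ≤⟨ *-monoʳ-≤ m (*-monoˡ-≤ c (≤ᵇ⇒≤ 2852 3000 tt)) ⟩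
  m * (3000 * c)                     ∎)
  where
  open ≤-Reasoning
  expand : ∀ n a → (2 * n) * (42 * a + 40) ≡ 84 * (n * a) + 80 * n
  expand = solve-∀
  collect : ∀ m c → 84 * (33 * (m * c)) + 80 * (m * c) ≡ m * (2852 * c)
  collect = solve-∀

repetition-cost-≤ : ∀ m k v c → 1 ≤ c → c + 2 < m → k ≤ c → v ≤ c →
                    1 + 2 * (8 * (m + k + 2)) * v ≤ 33 * (m * c)
repetition-cost-≤ m k v c 1≤c c+2<m k≤c v≤c = begin
  1 + 2 * (8 * (m + k + 2)) * v      ≡⟨ cong (1 +_) (sixteen (m + k + 2) v) ⟩
  1 + 16 * ((m + k + 2) * v)         ≤⟨ +-mono-≤ 1≤mc (*-monoʳ-≤ 16 (*-mono-≤ m+k+2≤2m v≤c)) ⟩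
  m * c + 16 * ((2 * m) * c)         ≡⟨ thirty-three m c ⟩
  33 * (m * c)                       ∎
  where
  open ≤-Reasoning
  1≤mc : 1 ≤ m * c
  1≤mc = *-mono-≤ (≤-trans (s≤s z≤n) c+2<m) 1≤c
  m+k+2≤2m : m + k + 2 ≤ 2 * m
  m+k+2≤2m = begin
    m + k + 2     ≡⟨ +-assoc m k 2 ⟩
    m + (k + 2)   ≤⟨ +-monoʳ-≤ m (<⇒≤ (≤-trans (s≤s (+-monoˡ-≤ 2 k≤c)) c+2<m)) ⟩
    m + m         ≡⟨ cong (m +_) (+-identityʳ m) ⟨
    2 * m         ∎
  sixteen : ∀ x v → 2 * (8 * x) * v ≡ 16 * (x * v)
  sixteen = solve-∀
  thirty-three : ∀ m c → m * c + 16 * ((2 * m) * c) ≡ 33 * (m * c)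
  thirty-three = solve-∀

lower-bound-arithmetic : ∀ L n a k v c →
  2 ^ L ≤ L + n → L + n < 2 * 2 ^ L → 2 ^ L ≤ 21 * a + 20 →
  n * a ≤ 1 + 2 * (8 * (L + n + k + 2)) * v → 1 ≤ c → k ≤ c → v ≤ c → L + n ≤ 3000 * c
lower-bound-arithmetic L n a k v c 2^L≤m m<2^L+1 2^L≤21a+20 na≤ 1≤c k≤c v≤c with L + n ≤? c + 2
... | yes m≤c+2 = begin
  L + n        ≤⟨ m≤c+2 ⟩
  c + 2        ≤⟨ +-monoʳ-≤ c (*-monoʳ-≤ 2 1≤c) ⟩
  3 * c        ≤⟨ *-monoˡ-≤ c (≤ᵇ⇒≤ 3 3000 tt) ⟩
  3000 * c     ∎
  where open ≤-Reasoning
... | no  m≰c+2 = square-bound (L + n) n a c (≤-trans (s≤s z≤n) c+2<m) m≤2n m≤42a+40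
    (≤-trans na≤ (repetition-cost-≤ (L + n) k v c 1≤c c+2<m k≤c v≤c))
    (≤-trans (m≤n+m n L) (≤-trans (≤-reflexive (sym (*-identityʳ (L + n)))) (*-monoʳ-≤ (L + n) 1≤c)))
  where
  c+2<m : c + 2 < L + n
  c+2<m = ≰⇒> m≰c+2
  m≤2n : L + n ≤ 2 * n
  m≤2n = ≤-trans (+-monoˡ-≤ n (2^L≤L+n⇒L≤n 2^L≤m)) (≤-reflexive (cong (n +_) (sym (+-identityʳ n))))
  m≤42a+40 : L + n ≤ 42 * a + 40
  m≤42a+40 = ≤-trans (<⇒≤ m<2^L+1) (≤-trans (*-monoʳ-≤ 2 2^L≤21a+20) (≤-reflexive (double a)))
    where
    double : ∀ a → 2 * (21 * a + 20) ≡ 42 * a + 40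
    double = solve-∀

lower-bound-at : ∀ L n → 2 ^ L ≤ L + n → L + n < 2 * 2 ^ L →
  (P : OnlineMAProtocol (SparseX (L + n)) (SparseY (L + n))) → OnlineMACorrect (SparseINDEX (L + n)) P →
  L + n ≤ 3000 * OnlineMAProtocol.cost P
lower-bound-at L n 2^L≤m m<2^L+1 P correct =
  lower-bound-arithmetic L n (2 ^ L / 21) k₂ v cost 2^L≤m m<2^L+1 (≤21*[/21]+20 (2 ^ L))
    (EncodingArgument.Counting.encoding-bound L n 2^L≤m P correct s (repetitions-suffice L n k₂))
    (s≤s z≤n) k₂≤cost (m≤n+m v _)
  where
  open OnlineMAProtocol P
  s = 8 * (L + n + k₂ + 2)
  k₂≤cost : k₂ ≤ cost
  k₂≤cost = ≤-trans (m≤n+m k₂ k₁) (≤-trans (n≤1+n _) (m≤m+n _ v))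

online-MA-lower-bound : ∃[ C ] ∃[ M₀ ] ((m : ℕ) → M₀ ≤ m →
                        (P : OnlineMAProtocol (SparseX m) (SparseY m)) →
                        OnlineMACorrect (SparseINDEX m) P → m ≤ C * OnlineMAProtocol.cost P)
online-MA-lower-bound = 3000 , 1 , bound
  where
  bound : (m : ℕ) → 1 ≤ m → (P : OnlineMAProtocol (SparseX m) (SparseY m)) →
          OnlineMACorrect (SparseINDEX m) P → m ≤ 3000 * OnlineMAProtocol.cost P
  bound m 1≤m with power-of-two-bracket m 1≤m
  ... | L , 2^L≤m , m<2^L+1 = subst Bound L+n≡m
          (lower-bound-at L (m ∸ L) (subst (2 ^ L ≤_) (sym L+n≡m) 2^L≤m) (subst (_< 2 * 2 ^ L) (sym L+n≡m) m<2^L+1))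
    where
    Bound : ℕ → Set
    Bound m = (P : OnlineMAProtocol (SparseX m) (SparseY m)) →
              OnlineMACorrect (SparseINDEX m) P → m ≤ 3000 * OnlineMAProtocol.cost P
    L≤m : L ≤ m
    L≤m = ≤-trans (<⇒≤ (n<2^n L)) 2^L≤m
    L+n≡m : L + (m ∸ L) ≡ m
    L+n≡m = m+[n∸m]≡n L≤m

corollary3p12 :
    (∃[ C ] ∃[ M₀ ] ((m : ℕ) → M₀ ≤ m →
        Σ (OneWayProtocol (SparseX m) (SparseY m)) λ P →
          OneWayCorrect (SparseINDEX m) P
          × OneWayProtocol.cost P ≤ C * (m * ⌈log₂ m ⌉)))
    ×
    (∃[ C ] ∃[ M₀ ] ((m : ℕ) → M₀ ≤ m →
        (P : OnlineMAProtocol (SparseX m) (SparseY m)) →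
        OnlineMACorrect (SparseINDEX m) P →
        m ≤ C * OnlineMAProtocol.cost P))
corollary3p12 = one-way-upper-bound , online-MA-lower-bound
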